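{- Let $q$ be a prime power, $A=\mathbb{F}_q[\theta]$, and let $v\in A$ be a monic irreducible polynomial of degree $\epsilon_v$, with $q_v:=q^{\epsilon_v}$ and $\operatorname{ord}_v$ the $v$-adic valuation on $\mathbb{F}_q(\theta)$ normalized by $\operatorname{ord}_v(v)=1$. Then: (1) For every integer $i\ge 0$, writing $i=\alpha\epsilon_v+\beta$ with $\alpha,\beta\in\mathbb{Z}_{\ge0}$ and $0\le\beta<\epsilon_v$, one has $$\operatorname{ord}_v(D_i)=q^\beta\cdot\frac{q_v^{\alpha}-1}{q_v-1}\quad\text{and}\quad \operatorname{ord}_v(L_i)=\alpha.$$ (2) $\operatorname{ord}_v(\Gamma_1)=0$; for every integer $s\ge 2$, $\operatorname{ord}_v(\Gamma_s)\le \frac{s-2}{q_v-1}$; and for every index $\mathfrak{s}=(s_1,\dots,s_r)\in\mathbb{N}^r$, $$\operatorname{ord}_v(\Gamma_{\mathfrak{s}})\le\frac{\operatorname{wt}(\mathfrak{s})-\operatorname{dep}(\mathfrak{s})-\operatorname{ht}(\mathfrak{s})}{q_v-1}.$$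
   Context: For $i\ge1$ put $[i]:=\theta^{q^i}-\theta\in A$. Set $D_0:=1$, $L_0:=1$, and for $i\ge1$, $D_i:=[i][i-1]^q\cdots[1]^{q^{i-1}}$ and $L_i:=(-1)^i[i][i-1]\cdots[1]$. For an integer $n\ge0$ with base-$q$ expansion $n=\sum_{j\ge0}n_jq^j$ ($0\le n_j\le q-1$), the Carlitz factorial is $\Gamma_{n+1}:=\prod_j D_j^{n_j}\in A$. For $\mathfrak{s}=(s_1,\dots,s_r)\in\mathbb{N}^r$ (with $\mathbb{N}=\{1,2,\dots\}$): $\Gamma_{\mathfrak{s}}:=\Gamma_{s_1}\cdots\Gamma_{s_r}$, $\operatorname{wt}(\mathfrak{s}):=s_1+\dots+s_r$, $\operatorname{dep}(\mathfrak{s}):=r$, and $\operatorname{ht}(\mathfrak{s})$ is the number of indices $i$ with $s_i\neq1$. -}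

module Defs where

open import Level using (0ℓ)
open import Data.Nat as ℕ using (ℕ; zero; suc; _<_; NonZero)
open import Data.Fin using (Fin)
open import Data.List using (List; []; _∷_; map; foldr)
open import Data.Product using (Σ; _×_)
open import Data.Sum using (_⊎_)
open import Relation.Nullary using (¬_)
open import Relation.Binary.PropositionalEquality using (_≡_; _≢_)
open import Relation.Binary.Definitions using (DecidableEquality)
open import Algebra.Structures using (IsCommutativeRing)
open import Function.Bundles using (_↔_)

-- A finite field F with q elements (q is then necessarily a prime power,
-- and every prime power q arises; F is unique up to isomorphism).
record FiniteField : Set₁ where
  field
    F      : Set
    _+F_   : F → F → F
    _*F_   : F → F → F
    -F_    : F → F
    0F     : F
    1F     : F
    isCommutativeRing : IsCommutativeRing _≡_ _+F_ _*F_ -F_ 0F 1F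
    _≟F_   : DecidableEquality F
    1≢0    : 1F ≢ 0F
    inverse : ∀ x → x ≢ 0F → Σ F (λ y → (x *F y) ≡ 1F)
    q      : ℕ
    enumeration : F ↔ Fin q

-- Polynomials A = F[θ], coefficient lists (lowest degree first),
-- compared up to trailing zeros via their coefficient functions.
module Carlitz (𝔽 : FiniteField) where
  open FiniteField 𝔽

  Poly : Set
  Poly = List F

  coeff : Poly → ℕ → F
  coeff []      _       = 0F
  coeff (a ∷ p) zero    = a
  coeff (a ∷ p) (suc n) = coeff p n

  infix 4 _≈ₚ_
  _≈ₚ_ : Poly → Poly → Set
  p ≈ₚ r = ∀ n → coeff p n ≡ coeff r n

  infixl 6 _+ₚ_ _-ₚ_
  infixl 7 _*ₚ_
  infixr 8 _^ₚ_
  infix 4 _∣ₚ_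

  _+ₚ_ : Poly → Poly → Poly
  []      +ₚ r       = r
  (a ∷ p) +ₚ []      = a ∷ p
  (a ∷ p) +ₚ (b ∷ r) = (a +F b) ∷ (p +ₚ r)

  -ₚ_ : Poly → Poly
  -ₚ p = map -F_ p

  _-ₚ_ : Poly → Poly → Poly
  p -ₚ r = p +ₚ (-ₚ r)

  _*ₚ_ : Poly → Poly → Poly
  []      *ₚ r = []
  (a ∷ p) *ₚ r = map (a *F_) r +ₚ (0F ∷ (p *ₚ r))

  1ₚ : Poly
  1ₚ = 1F ∷ []

  θ : Poly
  θ = 0F ∷ 1F ∷ []

  _^ₚ_ : Poly → ℕ → Poly
  p ^ₚ zero  = 1ₚ
  p ^ₚ suc n = p *ₚ (p ^ₚ n)

  _∣ₚ_ : Poly → Poly → Set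
  a ∣ₚ b = Σ Poly (λ c → a *ₚ c ≈ₚ b)

  IsUnit : Poly → Set
  IsUnit a = Σ Poly (λ c → a *ₚ c ≈ₚ 1ₚ)

  MonicOfDegree : Poly → ℕ → Set
  MonicOfDegree v d = (coeff v d ≡ 1F) × (∀ n → d < n → coeff v n ≡ 0F)

  Irreducible : Poly → Set
  Irreducible v = (¬ IsUnit v) × (∀ a b → v ≈ₚ a *ₚ b → IsUnit a ⊎ IsUnit b)

  HasOrd : Poly → Poly → ℕ → Set
  HasOrd v f n = (v ^ₚ n ∣ₚ f) × ¬ (v ^ₚ suc n ∣ₚ f)

  br : ℕ → Poly
  br i = θ ^ₚ (q ℕ.^ i) -ₚ θ

  D : ℕ → Poly
  D zero    = 1ₚ
  D (suc i) = br (suc i) *ₚ (D i ^ₚ q)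

  L : ℕ → Poly
  L zero    = 1ₚ
  L (suc i) = -ₚ (br (suc i) *ₚ L i)

  -- ∏_{j ≥ j0} D_j^{n_j} over the base-(suc k) digits of n, with fuel
  digitProd : (k fuel j n : ℕ) → Poly
  digitProd k zero       j n = 1ₚ
  digitProd k (suc fuel) j n =
    (D j ^ₚ (n ℕ.% suc k)) *ₚ digitProd k fuel (suc j) (n ℕ./ suc k)

  -- Carlitz factorial Γ_{n+1} = ∏_j D_j^{n_j}  (n = Σ n_j q^j); fuel n suffices
  -- since n has at most n base-q digits (q ≥ 2). Here Γ m for m ≥ 1.
  Γ : ℕ → Poly
  Γ zero    = 1ₚ   -- not used (Γ is indexed by positive integers)
  Γ (suc n) with q
  ... | zero  = 1ₚ  -- impossible: a field has q ≥ 2 elements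
  ... | suc k = digitProd k n zero n

  Γ-idx : List ℕ → Poly
  Γ-idx = foldr (λ s acc → Γ s *ₚ acc) 1ₚ

  wt : List ℕ → ℕ
  wt = foldr ℕ._+_ 0

  dep : List ℕ → ℕ
  dep = Data.List.length

  ht : List ℕ → ℕ
  ht []      = 0
  ht (1 ∷ s) = ht s
  ht (_ ∷ s) = suc (ht s)

{-# OPTIONS --safe #-}

-- The brackets [i] = θ^(q^i) − θ are squarefree, as their derivative is −1, and
-- v ∣ [i] exactly when ε ∣ i.  Indeed x ↦ x^(q^i) is a ring endomorphism of A fixing
-- F_q, so v ∣ [i] makes every residue modulo v a root of X^(q^i) − X, which by root
-- counting forces ε ≤ i; and root counting for v itself shows that two of θ, θ^q, …,
-- θ^(q^ε) are congruent modulo v, whence v ∣ [ε].  So ord_v [i] is 1 or 0 according as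
-- ε ∣ i, and the recursions D_i = [i] D_(i−1)^q, L_i = −[i] L_(i−1) give ord_v D_i and
-- ord_v L_i.  Since ord_v D_j · (q_v − 1) < q^j, summing over the base-q digits of s − 1
-- bounds ord_v Γ_s, and adding over the entries of 𝔰 bounds ord_v Γ_𝔰.

module Submission where

open import Level using (0ℓ)
open import Algebra.Bundles using (CommutativeRing; RawRing)
import Algebra.Properties.AbelianGroup as AbelianGroupProperties
import Algebra.Properties.CommutativeMonoid.Sum as CommutativeMonoidSum
import Algebra.Properties.CommutativeSemiring.Binomial as Binomial
import Algebra.Properties.CommutativeSemiring.Exp as CommutativeSemiringExp
import Algebra.Properties.Monoid.Sum as MonoidSum
import Algebra.Properties.Ring as RingProperties
import Algebra.Properties.Semiring.Exp as SemiringExp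
import Algebra.Properties.Semiring.Mult as SemiringMult
import Algebra.Properties.Semiring.Sum as SemiringSum
import Algebra.Solver.Ring.AlmostCommutativeRing as Solver
open import Data.Empty using (⊥-elim)
open import Data.Fin as Fin using (Fin; zero; suc; toℕ; fromℕ; fromℕ<; inject₁; inject≤; remQuot; combine)
open import Data.Fin.Permutation using (Permutation; permutation)
import Data.Fin.Properties as Fin
open import Data.List using (List; []; _∷_; map; length; tabulate; take)
import Data.List.Properties as List
open import Data.List.Relation.Unary.All as All using (All; []; _∷_)
import Data.List.Relation.Unary.All.Properties as All
open import Data.Maybe using (Maybe; just; nothing)
open import Data.Nat as ℕ using (ℕ; zero; suc; _≤_; z≤n; s≤s; _<_)
open import Data.Nat.Combinatorics using (_C_; nCn≡1; nC1≡n)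
import Data.Nat.DivMod as ℕ
import Data.Nat.Properties as ℕ
open import Data.Product using (_×_; _,_; proj₁; proj₂; Σ)
open import Data.Sum using (_⊎_; inj₁; inj₂; [_,_])
open import Data.Unit using (⊤; tt)
open import Function using (_∘_; Inverse; Injective)
open import Relation.Binary.Definitions using (tri<; tri≈; tri>)
open import Relation.Binary.PropositionalEquality as ≡ using (_≡_; _≢_; refl; cong; cong₂)
import Relation.Binary.Reasoning.Setoid as SetoidReasoning
open import Relation.Nullary using (yes; no; ¬_; Dec)
import Tactic.RingSolver.Core.AlmostCommutativeRing as Reflective
open import Defs

-- The ring solver of Algebra.Solver.Ring for any commutative ring, with integer
-- coefficients (a , b) standing for a − b.  Comparing coefficients by a + d ≟ b + c
-- lets it cancel terms such as x − x, which the reflective solver cannot do without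
-- decidable equality on the carrier.
module IntegerCoefficientSolver (R : CommutativeRing 0ℓ 0ℓ) where
  open import Tactic.RingSolver using (solve-∀)
  open CommutativeRing R
  open SemiringMult semiring using (×-homo-+; ×-congˡ; ×1-homo-*) renaming (_×_ to _·_)
  open RingProperties ring using (-‿distribˡ-*; -‿distribʳ-*)
  open AbelianGroupProperties +-abelianGroup using (⁻¹-involutive; ⁻¹-∙-comm; ⁻¹-anti-homo‿-; ε⁻¹≈ε)
  open SetoidReasoning setoid

  private
    R′ : Reflective.AlmostCommutativeRing 0ℓ 0ℓ
    R′ = Reflective.fromCommutativeRing R (λ _ → nothing)

    open Reflective.AlmostCommutativeRing R′ using () renaming
      (_+_ to _+′_; _*_ to _*′_; -_ to -′_; _≈_ to _≈′_)

    -‿+-interchange : ∀ x y z w → (x +′ y) +′ -′ (z +′ w) ≈′ (x +′ -′ z) +′ (y +′ -′ w)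
    -‿+-interchange = solve-∀ R′

    *-expand : ∀ x y z w → (x +′ y) *′ (z +′ w) ≈′ (x *′ z +′ y *′ w) +′ (x *′ w +′ y *′ z)
    *-expand = solve-∀ R′

    +-interchange : ∀ a b c d → (a +′ b) +′ (c +′ d) ≈′ (a +′ c) +′ (b +′ d)
    +-interchange = solve-∀ R′

    +-rotate : ∀ a b c d → (a +′ b) +′ (c +′ d) ≈′ (a +′ d) +′ (b +′ c)
    +-rotate = solve-∀ R′

    -x*-y≈x*y : ∀ x y → - x * - y ≈ x * y
    -x*-y≈x*y x y = trans (sym (-‿distribˡ-* x (- y))) (trans (-‿cong (sym (-‿distribʳ-* x y))) (⁻¹-involutive _))

    difference-* : ∀ x y z w → (x * z + y * w) - (x * w + y * z) ≈ (x - y) * (z - w)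
    difference-* x y z w = begin
      (x * z + y * w) - (x * w + y * z)
        ≈⟨ +-cong (+-congˡ (sym (-x*-y≈x*y y w)))
                  (trans (sym (⁻¹-∙-comm _ _)) (+-cong (-‿distribʳ-* x w) (-‿distribˡ-* y z))) ⟩
      (x * z + - y * - w) + (x * - w + - y * z) ≈⟨ sym (*-expand x (- y) z (- w)) ⟩
      (x - y) * (z - w) ∎

    difference-cong : ∀ {x y z w} → x + w ≈ y + z → x - y ≈ z - w
    difference-cong {x} {y} {z} {w} x+w≈y+z = begin
      x - y                 ≈⟨ sym (+-identityʳ _) ⟩
      (x - y) + 0#          ≈⟨ +-congˡ (sym (-‿inverseʳ w)) ⟩
      (x - y) + (w - w)     ≈⟨ +-interchange x (- y) w (- w) ⟩
      (x + w) + (- y - w)   ≈⟨ +-cong x+w≈y+z (trans (⁻¹-∙-comm y w) (-‿cong (+-comm y w))) ⟩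
      (y + z) - (w + y)     ≈⟨ +-congˡ (sym (⁻¹-∙-comm w y)) ⟩
      (y + z) + (- w - y)   ≈⟨ +-rotate y z (- w) (- y) ⟩
      (y - y) + (z - w)     ≈⟨ +-congʳ (-‿inverseʳ y) ⟩
      0# + (z - w)          ≈⟨ +-identityˡ _ ⟩
      z - w                 ∎

  ℤ-rawRing : RawRing 0ℓ 0ℓ
  ℤ-rawRing = record
    { Carrier = ℕ × ℕ
    ; _≈_ = _≡_
    ; _+_ = λ { (a , b) (c , d) → (a ℕ.+ c , b ℕ.+ d) }
    ; _*_ = λ { (a , b) (c , d) → (a ℕ.* c ℕ.+ b ℕ.* d , a ℕ.* d ℕ.+ b ℕ.* c) }
    ; -_ = λ { (a , b) → (b , a) }
    ; 0# = (0 , 0)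
    ; 1# = (1 , 0)
    }

  ⟦_⟧ℤ : ℕ × ℕ → Carrier
  ⟦ a , b ⟧ℤ = a · 1# - b · 1#

  ⟦⟧ℤ-homomorphism : ℤ-rawRing Solver.-Raw-AlmostCommutative⟶ Solver.fromCommutativeRing R
  ⟦⟧ℤ-homomorphism = record
    { ⟦_⟧ = ⟦_⟧ℤ
    ; +-homo = λ { (a , b) (c , d) →
        trans (+-cong (×-homo-+ 1# a c) (-‿cong (×-homo-+ 1# b d))) (-‿+-interchange _ _ _ _) }
    ; *-homo = λ { (a , b) (c , d) →
        trans (+-cong (homo-+* a c b d) (-‿cong (homo-+* a d b c))) (difference-* _ _ _ _) }
    ; -‿homo = λ { (a , b) → sym (⁻¹-anti-homo‿- _ _) }
    ; 0-homo = -‿inverseʳ 0#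
    ; 1-homo = trans (+-congˡ ε⁻¹≈ε) (trans (+-identityʳ _) (+-identityʳ _))
    }
    where
    homo-+* : ∀ a b c d → (a ℕ.* b ℕ.+ c ℕ.* d) · 1# ≈ a · 1# * b · 1# + c · 1# * d · 1#
    homo-+* a b c d = trans (×-homo-+ 1# (a ℕ.* b) (c ℕ.* d)) (+-cong (×1-homo-* a b) (×1-homo-* c d))

  ⟦⟧ℤ-≈? : ∀ x y → Maybe (⟦ x ⟧ℤ ≈ ⟦ y ⟧ℤ)
  ⟦⟧ℤ-≈? (a , b) (c , d) with a ℕ.+ d ℕ.≟ b ℕ.+ c
  ... | yes a+d≡b+c = just (difference-cong
          (trans (sym (×-homo-+ 1# a d)) (trans (×-congˡ a+d≡b+c) (×-homo-+ 1# b c))))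
  ... | no _ = nothing

  open import Algebra.Solver.Ring ℤ-rawRing (Solver.fromCommutativeRing R) ⟦⟧ℤ-homomorphism ⟦⟧ℤ-≈? public

module FiniteFieldArithmetic (𝔽 : FiniteField) where
  open ≡.≡-Reasoning
  open FiniteField 𝔽

  F-commutativeRing : CommutativeRing 0ℓ 0ℓ
  F-commutativeRing = record { isCommutativeRing = isCommutativeRing }

  module F = CommutativeRing F-commutativeRing
  module F-Properties = RingProperties F.ring
  module F-Solver = IntegerCoefficientSolver F-commutativeRing
  open SemiringExp F.semiring public using () renaming (_^_ to _^F_)
  open SemiringMult F.semiring public using () renaming (_×_ to _×F_)

  ×F-1 : ∀ n x → (n ×F x) ≡ ((n ×F 1F) *F x)
  ×F-1 n x = ≡.sym (≡.trans (SemiringMult.×-assoc-* F.semiring n 1F x) (cong (n ×F_) (F.*-identityˡ x)))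

  x*y≡0⇒y≡0 : ∀ {x y} → x ≢ 0F → (x *F y) ≡ 0F → y ≡ 0F
  x*y≡0⇒y≡0 {x} {y} x≢0 xy≡0 = begin
    y                ≡⟨ F.*-identityˡ y ⟨
    1F *F y          ≡⟨ cong (_*F y) (≡.trans (F.*-comm x⁻¹ x) xx⁻¹≡1) ⟨
    (x⁻¹ *F x) *F y  ≡⟨ F.*-assoc x⁻¹ x y ⟩
    x⁻¹ *F (x *F y)  ≡⟨ cong (x⁻¹ *F_) xy≡0 ⟩
    x⁻¹ *F 0F        ≡⟨ F.zeroʳ x⁻¹ ⟩
    0F               ∎
    where
    x⁻¹ = proj₁ (inverse x x≢0)
    xx⁻¹≡1 = proj₂ (inverse x x≢0)

  *-nonzero : ∀ {x y} → x ≢ 0F → y ≢ 0F → (x *F y) ≢ 0F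
  *-nonzero x≢0 y≢0 xy≡0 = y≢0 (x*y≡0⇒y≡0 x≢0 xy≡0)

  *-cancelʳ-nonzero : ∀ {x y z} → z ≢ 0F → (x *F z) ≡ (y *F z) → x ≡ y
  *-cancelʳ-nonzero {x} {y} {z} z≢0 xz≡yz = F-Properties.x∙y⁻¹≈ε⇒x≈y x y (x*y≡0⇒y≡0 z≢0 (begin
    z *F (x +F (-F y))          ≡⟨ solve 3 (λ x y z → z :* (x :- y) := x :* z :- y :* z) refl x y z ⟩
    (x *F z) +F (-F (y *F z))   ≡⟨ cong (λ w → w +F (-F (y *F z))) xz≡yz ⟩
    (y *F z) +F (-F (y *F z))   ≡⟨ F.-‿inverseʳ _ ⟩
    0F                          ∎))
    where open F-Solver using (solve; _:=_; _:-_; _:*_)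

  private
    module E = Inverse enumeration

    to-injective : Injective _≡_ _≡_ E.to
    to-injective {x} {y} e = ≡.trans (≡.sym (E.strictlyInverseʳ x)) (≡.trans (cong E.from e) (E.strictlyInverseʳ y))

  element : Fin q → F
  element = E.from

  element-injective : Injective _≡_ _≡_ element
  element-injective {i} {j} e = ≡.trans (≡.sym (E.strictlyInverseˡ i)) (≡.trans (cong E.to e) (E.strictlyInverseˡ j))

  2≤q : 2 ≤ q
  2≤q = two-points (E.to 0F) (E.to 1F) (λ e → 1≢0 (to-injective (≡.sym e)))
    where
    two-points : ∀ {n} (i j : Fin n) → i ≢ j → 2 ≤ n
    two-points {suc (suc n)} _ _ _ = s≤s (s≤s z≤n)
    two-points {suc zero} zero zero i≢j = ⊥-elim (i≢j refl)

  1≤q : 1 ≤ q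
  1≤q = ℕ.≤-trans (s≤s z≤n) 2≤q

  -- Fermat's little theorem without dividing by a^(q − 1): over all x ∈ F,
  -- ∏ a = ∏ ifNonzero a x · ∏ ifZero a x.  The first product is 1, since x ↦ a x
  -- permutes F and unitPart (a x) = ifNonzero a x · unitPart x; the second is a,
  -- since F has exactly one zero.
  private
    module ∏ = CommutativeMonoidSum F.*-commutativeMonoid
    ∏ : ∀ {n} → (Fin n → F) → F
    ∏ = ∏.sum

    unitPart : F → F
    unitPart x with x ≟F 0F
    ... | yes _ = 1F
    ... | no _ = x

    unitPart≢0 : ∀ x → unitPart x ≢ 0F
    unitPart≢0 x with x ≟F 0F
    ... | yes _ = 1≢0
    ... | no x≢0 = x≢0

    ifNonzero ifZero : F → F → F
    ifNonzero a x with x ≟F 0F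
    ... | yes _ = 1F
    ... | no _ = a
    ifZero a x with x ≟F 0F
    ... | yes _ = a
    ... | no _ = 1F

    ifNonzero*ifZero : ∀ a x → (ifNonzero a x *F ifZero a x) ≡ a
    ifNonzero*ifZero a x with x ≟F 0F
    ... | yes _ = F.*-identityˡ a
    ... | no _ = F.*-identityʳ a

    unitPart-* : ∀ {a} → a ≢ 0F → ∀ x → unitPart (a *F x) ≡ (ifNonzero a x *F unitPart x)
    unitPart-* {a} a≢0 x with x ≟F 0F | (a *F x) ≟F 0F
    ... | yes _   | yes _    = ≡.sym (F.*-identityˡ 1F)
    ... | yes x≡0 | no ax≢0  = ⊥-elim (ax≢0 (≡.trans (cong (a *F_) x≡0) (F.zeroʳ a)))
    ... | no x≢0  | yes ax≡0 = ⊥-elim (x≢0 (x*y≡0⇒y≡0 a≢0 ax≡0))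
    ... | no _    | no _     = refl

    ∏-nonzero : ∀ {n} (f : Fin n → F) → (∀ i → f i ≢ 0F) → ∏ f ≢ 0F
    ∏-nonzero {zero} f _ = 1≢0
    ∏-nonzero {suc n} f f≢0 = *-nonzero (f≢0 zero) (∏-nonzero (f ∘ suc) (f≢0 ∘ suc))

    ∏-const : ∀ n a → ∏ {n} (λ _ → a) ≡ a ^F n
    ∏-const zero a = refl
    ∏-const (suc n) a = cong (a *F_) (∏-const n a)

    ifZero-zero : ∀ a {x} → x ≡ 0F → ifZero a x ≡ a
    ifZero-zero a {x} x≡0 with x ≟F 0F
    ... | yes _ = refl
    ... | no x≢0 = ⊥-elim (x≢0 x≡0)

    ifZero-nonzero : ∀ a {x} → x ≢ 0F → ifZero a x ≡ 1F
    ifZero-nonzero a {x} x≢0 with x ≟F 0F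
    ... | yes x≡0 = ⊥-elim (x≢0 x≡0)
    ... | no _ = refl

    ∏-ones : ∀ {n} (f : Fin n → F) → (∀ i → f i ≡ 1F) → ∏ f ≡ 1F
    ∏-ones {n} f f≡1 = ≡.trans (∏.sum-cong-≗ f≡1) (∏.sum-replicate-zero n)

    ∏-ifZero : ∀ a {n} (e : Fin n → F) → Injective _≡_ _≡_ e → ∀ i₀ → e i₀ ≡ 0F → ∏ (ifZero a ∘ e) ≡ a
    ∏-ifZero a e e-inj zero e₀≡0 = begin
      ifZero a (e zero) *F ∏ (ifZero a ∘ e ∘ suc) ≡⟨ cong₂ _*F_ (ifZero-zero a e₀≡0) (∏-ones _ λ j → ifZero-nonzero a (e≢0 (suc j) λ ())) ⟩
      a *F 1F                                       ≡⟨ F.*-identityʳ a ⟩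
      a                                             ∎
      where
      e≢0 : ∀ j → j ≢ zero → e j ≢ 0F
      e≢0 j j≢0 eⱼ≡0 = j≢0 (e-inj (≡.trans eⱼ≡0 (≡.sym e₀≡0)))
    ∏-ifZero a e e-inj (suc i₀) eᵢ≡0 = begin
      ifZero a (e zero) *F ∏ (ifZero a ∘ e ∘ suc) ≡⟨ cong₂ _*F_ (ifZero-nonzero a e₀≢0) (∏-ifZero a (e ∘ suc) (Fin.suc-injective ∘ e-inj) i₀ eᵢ≡0) ⟩
      1F *F a                                       ≡⟨ F.*-identityˡ a ⟩
      a                                             ∎
      where
      e₀≢0 : e zero ≢ 0F
      e₀≢0 e₀≡0 with e-inj (≡.trans e₀≡0 (≡.sym eᵢ≡0))
      ... | ()

    ·-permutation : ∀ {a} → a ≢ 0F → Permutation q q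
    ·-permutation {a} a≢0 = permutation (λ i → E.to (a *F E.from i)) (λ i → E.to (a⁻¹ *F E.from i))
      (cancel a a⁻¹ aa⁻¹≡1) (cancel a⁻¹ a (≡.trans (F.*-comm a⁻¹ a) aa⁻¹≡1))
      where
      a⁻¹ = proj₁ (inverse a a≢0)
      aa⁻¹≡1 = proj₂ (inverse a a≢0)
      cancel : ∀ b c → (b *F c) ≡ 1F → ∀ i → E.to (b *F E.from (E.to (c *F E.from i))) ≡ i
      cancel b c bc≡1 i = begin
        E.to (b *F E.from (E.to (c *F E.from i))) ≡⟨ cong (λ x → E.to (b *F x)) (E.strictlyInverseʳ _) ⟩
        E.to (b *F (c *F E.from i))               ≡⟨ cong E.to (F.*-assoc b c _) ⟨
        E.to ((b *F c) *F E.from i)               ≡⟨ cong (λ x → E.to (x *F E.from i)) bc≡1 ⟩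
        E.to (1F *F E.from i)                     ≡⟨ cong E.to (F.*-identityˡ _) ⟩
        E.to (E.from i)                           ≡⟨ E.strictlyInverseˡ i ⟩
        i                                         ∎

    ∏-ifNonzero : ∀ {a} → a ≢ 0F → ∏ (ifNonzero a ∘ E.from) ≡ 1F
    ∏-ifNonzero {a} a≢0 = ≡.sym (*-cancelʳ-nonzero (∏-nonzero (unitPart ∘ E.from) (unitPart≢0 ∘ E.from)) (begin
      1F *F ∏ (unitPart ∘ E.from)                           ≡⟨ F.*-identityˡ _ ⟩
      ∏ (unitPart ∘ E.from)                                 ≡⟨ ∏.sum-permute (unitPart ∘ E.from) (·-permutation a≢0) ⟩
      ∏ (λ i → unitPart (E.from (E.to (a *F E.from i))))
        ≡⟨ ∏.sum-cong-≗ (λ i → ≡.trans (cong unitPart (E.strictlyInverseʳ _)) (unitPart-* a≢0 (E.from i))) ⟩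
      ∏ (λ i → ifNonzero a (E.from i) *F unitPart (E.from i)) ≡⟨ ∏.∑-distrib-+ (ifNonzero a ∘ E.from) (unitPart ∘ E.from) ⟩
      ∏ (ifNonzero a ∘ E.from) *F ∏ (unitPart ∘ E.from)     ∎))

  fermat : ∀ a → a ^F q ≡ a
  fermat a with a ≟F 0F
  ... | yes refl = 0^q
    where
    0^q : 0F ^F q ≡ 0F
    0^q with q | 2≤q
    ... | suc n | _ = F.zeroˡ _
  ... | no a≢0 = begin
    a ^F q                                                        ≡⟨ ∏-const q a ⟨
    ∏ {q} (λ _ → a)                                                ≡⟨ ∏.sum-cong-≗ (λ i → ≡.sym (ifNonzero*ifZero a (E.from i))) ⟩
    ∏ (λ i → ifNonzero a (E.from i) *F ifZero a (E.from i))        ≡⟨ ∏.∑-distrib-+ (ifNonzero a ∘ E.from) (ifZero a ∘ E.from) ⟩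
    ∏ (ifNonzero a ∘ E.from) *F ∏ (ifZero a ∘ E.from)
      ≡⟨ cong₂ _*F_ (∏-ifNonzero a≢0) (∏-ifZero a E.from element-injective (E.to 0F) (E.strictlyInverseʳ 0F)) ⟩
    1F *F a                                                        ≡⟨ F.*-identityˡ a ⟩
    a                                                              ∎

module Polynomials (𝔽 : FiniteField) where
  open ≡.≡-Reasoning
  open FiniteField 𝔽
  open Carlitz 𝔽
  open FiniteFieldArithmetic 𝔽 using (module F; module F-Properties; module F-Solver)

  convolution : (ℕ → F) → (ℕ → F) → ℕ → F
  convolution f g zero = f 0 *F g 0
  convolution f g (suc n) = (f 0 *F g (suc n)) +F convolution (f ∘ suc) g n

  convolution-zeroˡ : ∀ g n → convolution (λ _ → 0F) g n ≡ 0F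
  convolution-zeroˡ g zero = F.zeroˡ _
  convolution-zeroˡ g (suc n) = ≡.trans (cong₂ _+F_ (F.zeroˡ _) (convolution-zeroˡ g n)) (F.+-identityˡ 0F)

  convolution-zeroʳ : ∀ f n → convolution f (λ _ → 0F) n ≡ 0F
  convolution-zeroʳ f zero = F.zeroʳ _
  convolution-zeroʳ f (suc n) = ≡.trans (cong₂ _+F_ (F.zeroʳ _) (convolution-zeroʳ (f ∘ suc) n)) (F.+-identityˡ 0F)

  convolution-cong : ∀ {f f′ g g′} → (∀ n → f n ≡ f′ n) → (∀ n → g n ≡ g′ n) → ∀ n → convolution f g n ≡ convolution f′ g′ n
  convolution-cong f≗f′ g≗g′ zero = cong₂ _*F_ (f≗f′ 0) (g≗g′ 0)
  convolution-cong f≗f′ g≗g′ (suc n) = cong₂ _+F_ (cong₂ _*F_ (f≗f′ 0) (g≗g′ (suc n))) (convolution-cong (f≗f′ ∘ suc) g≗g′ n)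

  coeff-+ : ∀ p r n → coeff (p +ₚ r) n ≡ (coeff p n +F coeff r n)
  coeff-+ [] r n = ≡.sym (F.+-identityˡ _)
  coeff-+ (a ∷ p) [] n = ≡.sym (F.+-identityʳ _)
  coeff-+ (a ∷ p) (b ∷ r) zero = refl
  coeff-+ (a ∷ p) (b ∷ r) (suc n) = coeff-+ p r n

  coeff-map : ∀ a p n → coeff (map (a *F_) p) n ≡ (a *F coeff p n)
  coeff-map a [] n = ≡.sym (F.zeroʳ a)
  coeff-map a (b ∷ p) zero = refl
  coeff-map a (b ∷ p) (suc n) = coeff-map a p n

  coeff-neg : ∀ p n → coeff (-ₚ p) n ≡ (-F coeff p n)
  coeff-neg [] n = ≡.sym F-Properties.-0#≈0#
  coeff-neg (b ∷ p) zero = refl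
  coeff-neg (b ∷ p) (suc n) = coeff-neg p n

  coeff-* : ∀ p r n → coeff (p *ₚ r) n ≡ convolution (coeff p) (coeff r) n
  coeff-* [] r n = ≡.sym (convolution-zeroˡ (coeff r) n)
  coeff-* (a ∷ p) r zero = ≡.trans (coeff-+ (map (a *F_) r) (0F ∷ (p *ₚ r)) 0) (≡.trans (F.+-identityʳ _) (coeff-map a r 0))
  coeff-* (a ∷ p) r (suc n) = ≡.trans (coeff-+ (map (a *F_) r) (0F ∷ (p *ₚ r)) (suc n)) (cong₂ _+F_ (coeff-map a r (suc n)) (coeff-* p r n))

  -- _≈ₚ_ wrapped in a record, so that the polynomials it relates can be inferred.
  infix 4 _≃_
  record _≃_ (p r : Poly) : Set where
    constructor mk
    field coeff-≡ : p ≈ₚ r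
  open _≃_ public

  ≃-refl : ∀ {p} → p ≃ p
  ≃-refl = mk λ n → refl

  ≃-sym : ∀ {p r} → p ≃ r → r ≃ p
  ≃-sym (mk e) = mk λ n → ≡.sym (e n)

  ≃-trans : ∀ {p r s} → p ≃ r → r ≃ s → p ≃ s
  ≃-trans (mk e) (mk f) = mk λ n → ≡.trans (e n) (f n)

  +-cong : ∀ {p p′ r r′} → p ≃ p′ → r ≃ r′ → (p +ₚ r) ≃ (p′ +ₚ r′)
  +-cong {p} {p′} {r} {r′} (mk e) (mk f) = mk λ n →
    ≡.trans (coeff-+ p r n) (≡.trans (cong₂ _+F_ (e n) (f n)) (≡.sym (coeff-+ p′ r′ n)))

  *-cong : ∀ {p p′ r r′} → p ≃ p′ → r ≃ r′ → (p *ₚ r) ≃ (p′ *ₚ r′)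
  *-cong {p} {p′} {r} {r′} (mk e) (mk f) = mk λ n →
    ≡.trans (coeff-* p r n) (≡.trans (convolution-cong e f n) (≡.sym (coeff-* p′ r′ n)))

  -‿cong : ∀ {p p′} → p ≃ p′ → (-ₚ p) ≃ (-ₚ p′)
  -‿cong {p} {p′} (mk e) = mk λ n → ≡.trans (coeff-neg p n) (≡.trans (cong -F_ (e n)) (≡.sym (coeff-neg p′ n)))

  +-assoc : ∀ p r s → ((p +ₚ r) +ₚ s) ≃ (p +ₚ (r +ₚ s))
  +-assoc p r s = mk λ n → begin
    coeff ((p +ₚ r) +ₚ s) n                ≡⟨ coeff-+ (p +ₚ r) s n ⟩
    coeff (p +ₚ r) n +F coeff s n          ≡⟨ cong (_+F coeff s n) (coeff-+ p r n) ⟩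
    (coeff p n +F coeff r n) +F coeff s n  ≡⟨ F.+-assoc _ _ _ ⟩
    coeff p n +F (coeff r n +F coeff s n)  ≡⟨ cong (coeff p n +F_) (coeff-+ r s n) ⟨
    coeff p n +F coeff (r +ₚ s) n          ≡⟨ coeff-+ p (r +ₚ s) n ⟨
    coeff (p +ₚ (r +ₚ s)) n                ∎

  +-comm : ∀ p r → (p +ₚ r) ≃ (r +ₚ p)
  +-comm p r = mk λ n → ≡.trans (coeff-+ p r n) (≡.trans (F.+-comm _ _) (≡.sym (coeff-+ r p n)))

  +-identityˡ : ∀ p → ([] +ₚ p) ≃ p
  +-identityˡ p = ≃-refl

  +-identityʳ : ∀ p → (p +ₚ []) ≃ p
  +-identityʳ p = mk λ n → ≡.trans (coeff-+ p [] n) (F.+-identityʳ _)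

  -‿inverseʳ : ∀ p → (p +ₚ (-ₚ p)) ≃ []
  -‿inverseʳ p = mk λ n →
    ≡.trans (coeff-+ p (-ₚ p) n) (≡.trans (cong (coeff p n +F_) (coeff-neg p n)) (F.-‿inverseʳ _))

  -‿inverseˡ : ∀ p → ((-ₚ p) +ₚ p) ≃ []
  -‿inverseˡ p = ≃-trans (+-comm (-ₚ p) p) (-‿inverseʳ p)

  shift : Poly → Poly
  shift p = 0F ∷ p

  shift-cong : ∀ {p p′} → p ≃ p′ → shift p ≃ shift p′
  shift-cong (mk e) = mk λ { zero → refl ; (suc n) → e n }

  shift-+ : ∀ p r → (shift p +ₚ shift r) ≃ shift (p +ₚ r)
  shift-+ p r = mk λ { zero → F.+-identityˡ 0F ; (suc n) → refl }

  shift-[] : shift [] ≃ []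
  shift-[] = mk λ { zero → refl ; (suc n) → refl }

  map-+ : ∀ a p r → map (a *F_) (p +ₚ r) ≃ (map (a *F_) p +ₚ map (a *F_) r)
  map-+ a p r = mk λ n → begin
    coeff (map (a *F_) (p +ₚ r)) n                        ≡⟨ coeff-map a (p +ₚ r) n ⟩
    a *F coeff (p +ₚ r) n                                 ≡⟨ cong (a *F_) (coeff-+ p r n) ⟩
    a *F (coeff p n +F coeff r n)                         ≡⟨ F.distribˡ _ _ _ ⟩
    (a *F coeff p n) +F (a *F coeff r n)                  ≡⟨ cong₂ _+F_ (coeff-map a p n) (coeff-map a r n) ⟨
    coeff (map (a *F_) p) n +F coeff (map (a *F_) r) n    ≡⟨ coeff-+ (map (a *F_) p) (map (a *F_) r) n ⟨
    coeff (map (a *F_) p +ₚ map (a *F_) r) n              ∎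

  map-+F : ∀ a b p → map ((a +F b) *F_) p ≃ (map (a *F_) p +ₚ map (b *F_) p)
  map-+F a b p = mk λ n → ≡.trans (coeff-map (a +F b) p n) (≡.trans (F.distribʳ _ _ _)
    (≡.sym (≡.trans (coeff-+ (map (a *F_) p) (map (b *F_) p) n) (cong₂ _+F_ (coeff-map a p n) (coeff-map b p n)))))

  map-map : ∀ a b p → map (a *F_) (map (b *F_) p) ≃ map ((a *F b) *F_) p
  map-map a b p = mk λ n → ≡.trans (coeff-map a (map (b *F_) p) n)
    (≡.trans (cong (a *F_) (coeff-map b p n)) (≡.trans (≡.sym (F.*-assoc _ _ _)) (≡.sym (coeff-map (a *F b) p n))))

  map-1 : ∀ p → map (1F *F_) p ≃ p
  map-1 p = mk λ n → ≡.trans (coeff-map 1F p n) (F.*-identityˡ _)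

  map-0 : ∀ p → map (0F *F_) p ≃ []
  map-0 p = mk λ n → ≡.trans (coeff-map 0F p n) (F.zeroˡ _)

  map-shift : ∀ a p → map (a *F_) (shift p) ≃ shift (map (a *F_) p)
  map-shift a p = mk λ { zero → F.zeroʳ a ; (suc n) → refl }

  *-zeroʳ : ∀ p → (p *ₚ []) ≃ []
  *-zeroʳ p = mk λ n → ≡.trans (coeff-* p [] n) (convolution-zeroʳ (coeff p) n)

  shift-* : ∀ p r → (shift p *ₚ r) ≃ shift (p *ₚ r)
  shift-* p r = +-cong (map-0 r) (≃-refl {shift (p *ₚ r)})

  +-interchange : ∀ x y z w → ((x +ₚ y) +ₚ (z +ₚ w)) ≃ ((x +ₚ z) +ₚ (y +ₚ w))
  +-interchange x y z w = mk λ n → begin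
    coeff ((x +ₚ y) +ₚ (z +ₚ w)) n                            ≡⟨ coeff-+⁴ x y z w n ⟩
    (coeff x n +F coeff y n) +F (coeff z n +F coeff w n)      ≡⟨ solve 4 (λ x y z w → (x :+ y) :+ (z :+ w) := (x :+ z) :+ (y :+ w)) refl _ _ _ _ ⟩
    (coeff x n +F coeff z n) +F (coeff y n +F coeff w n)      ≡⟨ coeff-+⁴ x z y w n ⟨
    coeff ((x +ₚ z) +ₚ (y +ₚ w)) n                            ∎
    where
    open F-Solver using (solve; _:=_; _:+_)
    coeff-+⁴ : ∀ x y z w n → coeff ((x +ₚ y) +ₚ (z +ₚ w)) n ≡ (coeff x n +F coeff y n) +F (coeff z n +F coeff w n)
    coeff-+⁴ x y z w n = ≡.trans (coeff-+ (x +ₚ y) (z +ₚ w) n) (cong₂ _+F_ (coeff-+ x y n) (coeff-+ z w n))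

  *-distribʳ : ∀ p r s → ((p +ₚ r) *ₚ s) ≃ ((p *ₚ s) +ₚ (r *ₚ s))
  *-distribʳ [] r s = ≃-refl
  *-distribʳ (a ∷ p) [] s = ≃-sym (+-identityʳ _)
  *-distribʳ (a ∷ p) (b ∷ r) s =
    ≃-trans (+-cong (map-+F a b s) (≃-trans (shift-cong (*-distribʳ p r s)) (≃-sym (shift-+ (p *ₚ s) (r *ₚ s)))))
            (+-interchange (map (a *F_) s) (map (b *F_) s) (shift (p *ₚ s)) (shift (r *ₚ s)))

  *-distribˡ : ∀ p r s → (p *ₚ (r +ₚ s)) ≃ ((p *ₚ r) +ₚ (p *ₚ s))
  *-distribˡ [] r s = ≃-refl
  *-distribˡ (a ∷ p) r s =
    ≃-trans (+-cong (map-+ a r s) (≃-trans (shift-cong (*-distribˡ p r s)) (≃-sym (shift-+ (p *ₚ r) (p *ₚ s)))))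
            (+-interchange (map (a *F_) r) (map (a *F_) s) (shift (p *ₚ r)) (shift (p *ₚ s)))

  map-* : ∀ a r s → (map (a *F_) r *ₚ s) ≃ map (a *F_) (r *ₚ s)
  map-* a [] s = ≃-refl
  map-* a (b ∷ r) s = ≃-trans (+-cong ≃-refl (shift-cong (map-* a r s)))
    (≃-sym (≃-trans (map-+ a (map (b *F_) s) (shift (r *ₚ s))) (+-cong (map-map a b s) (map-shift a (r *ₚ s)))))

  *-assoc : ∀ p r s → ((p *ₚ r) *ₚ s) ≃ (p *ₚ (r *ₚ s))
  *-assoc [] r s = ≃-refl
  *-assoc (a ∷ p) r s = ≃-trans (*-distribʳ (map (a *F_) r) (shift (p *ₚ r)) s)
    (+-cong (map-* a r s) (≃-trans (shift-* (p *ₚ r) s) (shift-cong (*-assoc p r s))))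

  *-identityˡ : ∀ p → (1ₚ *ₚ p) ≃ p
  *-identityˡ p = ≃-trans (+-cong (map-1 p) shift-[]) (+-identityʳ p)

  *-cons : ∀ r a p → (r *ₚ (a ∷ p)) ≃ (map (a *F_) r +ₚ shift (r *ₚ p))
  *-cons [] a p = mk λ { zero → refl ; (suc n) → refl }
  *-cons (b ∷ r) a p = mk λ
    { zero → begin
        coeff ((b ∷ r) *ₚ (a ∷ p)) 0   ≡⟨ coeff-+ (map (b *F_) (a ∷ p)) (shift (r *ₚ (a ∷ p))) 0 ⟩
        (b *F a) +F 0F                 ≡⟨ cong (_+F 0F) (F.*-comm b a) ⟩
        (a *F b) +F 0F                 ≡⟨ coeff-+ (map (a *F_) (b ∷ r)) (shift ((b ∷ r) *ₚ p)) 0 ⟨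
        coeff (map (a *F_) (b ∷ r) +ₚ shift ((b ∷ r) *ₚ p)) 0 ∎
    ; (suc n) → begin
        coeff ((b ∷ r) *ₚ (a ∷ p)) (suc n)             ≡⟨ coeff-+ (map (b *F_) (a ∷ p)) (shift (r *ₚ (a ∷ p))) (suc n) ⟩
        coeff (map (b *F_) p) n +F coeff (r *ₚ (a ∷ p)) n  ≡⟨ cong (coeff (map (b *F_) p) n +F_) (coeff-≡ (*-cons r a p) n) ⟩
        coeff (map (b *F_) p) n +F coeff (map (a *F_) r +ₚ shift (r *ₚ p)) n
          ≡⟨ cong₂ _+F_ (coeff-map b p n) (≡.trans (coeff-+ (map (a *F_) r) (shift (r *ₚ p)) n) (cong (_+F _) (coeff-map a r n))) ⟩
        (b *F coeff p n) +F ((a *F coeff r n) +F coeff (shift (r *ₚ p)) n)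
          ≡⟨ solve 3 (λ x y z → x :+ (y :+ z) := y :+ (x :+ z)) refl _ _ _ ⟩
        (a *F coeff r n) +F ((b *F coeff p n) +F coeff (shift (r *ₚ p)) n)
          ≡⟨ cong₂ _+F_ (coeff-map a r n) (≡.trans (coeff-+ (map (b *F_) p) (shift (r *ₚ p)) n) (cong (_+F _) (coeff-map b p n))) ⟨
        coeff (map (a *F_) r) n +F coeff ((b ∷ r) *ₚ p) n  ≡⟨ coeff-+ (map (a *F_) (b ∷ r)) (shift ((b ∷ r) *ₚ p)) (suc n) ⟨
        coeff (map (a *F_) (b ∷ r) +ₚ shift ((b ∷ r) *ₚ p)) (suc n) ∎ }
    where open F-Solver using (solve; _:=_; _:+_)

  *-comm : ∀ p r → (p *ₚ r) ≃ (r *ₚ p)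
  *-comm [] r = ≃-sym (*-zeroʳ r)
  *-comm (a ∷ p) r = ≃-trans (+-cong ≃-refl (shift-cong (*-comm p r))) (≃-sym (*-cons r a p))

  A-commutativeRing : CommutativeRing 0ℓ 0ℓ
  A-commutativeRing = record
    { Carrier = Poly
    ; _≈_ = _≃_
    ; _+_ = _+ₚ_
    ; _*_ = _*ₚ_
    ; -_ = -ₚ_
    ; 0# = []
    ; 1# = 1ₚ
    ; isCommutativeRing = record
      { isRing = record
        { +-isAbelianGroup = record
          { isGroup = record
            { isMonoid = record
              { isSemigroup = record
                { isMagma = record
                  { isEquivalence = record { refl = ≃-refl ; sym = ≃-sym ; trans = ≃-trans }
                  ; ∙-cong = +-cong }
                ; assoc = +-assoc }
              ; identity = +-identityˡ , +-identityʳ }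
            ; inverse = -‿inverseˡ , -‿inverseʳ
            ; ⁻¹-cong = -‿cong }
          ; comm = +-comm }
        ; *-cong = *-cong
        ; *-assoc = *-assoc
        ; *-identity = *-identityˡ , (λ p → ≃-trans (*-comm p 1ₚ) (*-identityˡ p))
        ; distrib = *-distribˡ , (λ p r s → *-distribʳ r s p)
        }
      ; *-comm = *-comm
      }
    }

  module A = CommutativeRing A-commutativeRing
  module A-Solver = IntegerCoefficientSolver A-commutativeRing
  module ≃-Reasoning = SetoidReasoning A.setoid
  open SemiringExp A.semiring using () renaming (_^_ to _^A_)

  const : F → Poly
  const c = c ∷ []

  const-cong : ∀ {a b} → a ≡ b → const a ≃ const b
  const-cong refl = ≃-refl

  const-0 : const 0F ≃ []
  const-0 = mk λ { zero → refl ; (suc n) → refl }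

  const-*ₚ : ∀ c r → (const c *ₚ r) ≃ map (c *F_) r
  const-*ₚ c r = ≃-trans (+-cong (≃-refl {map (c *F_) r}) shift-[]) (+-identityʳ _)

  const-* : ∀ a b → (const a *ₚ const b) ≃ const (a *F b)
  const-* a b = mk λ { zero → F.+-identityʳ _ ; (suc n) → refl }

  θ-*ₚ : ∀ p → (θ *ₚ p) ≃ shift p
  θ-*ₚ p = ≃-trans (+-cong (map-0 p) (shift-cong (*-identityˡ p))) (+-identityˡ (shift p))

  ∷-≃ : ∀ c p → (c ∷ p) ≃ (const c +ₚ (θ *ₚ p))
  ∷-≃ c p = ≃-sym (≃-trans (+-cong (≃-refl {const c}) (θ-*ₚ p)) (mk λ { zero → F.+-identityʳ c ; (suc n) → refl }))

  ^ₚ≃^A : ∀ x n → (x ^ₚ n) ≃ (x ^A n)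
  ^ₚ≃^A x zero = ≃-refl
  ^ₚ≃^A x (suc n) = *-cong (≃-refl {x}) (^ₚ≃^A x n)

  ^ₚ-congˡ : ∀ {x y} n → x ≃ y → (x ^ₚ n) ≃ (y ^ₚ n)
  ^ₚ-congˡ zero _ = ≃-refl
  ^ₚ-congˡ (suc n) x≃y = *-cong x≃y (^ₚ-congˡ n x≃y)

  ^ₚ-congʳ : ∀ x {m n} → m ≡ n → (x ^ₚ m) ≃ (x ^ₚ n)
  ^ₚ-congʳ x refl = ≃-refl

  ^ₚ-homo-* : ∀ x m n → (x ^ₚ (m ℕ.+ n)) ≃ ((x ^ₚ m) *ₚ (x ^ₚ n))
  ^ₚ-homo-* x m n = ≃-trans (^ₚ≃^A x (m ℕ.+ n)) (≃-trans (SemiringExp.^-homo-* A.semiring x m n)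
    (*-cong (≃-sym (^ₚ≃^A x m)) (≃-sym (^ₚ≃^A x n))))

  ^ₚ-assocʳ : ∀ x m n → ((x ^ₚ m) ^ₚ n) ≃ (x ^ₚ (m ℕ.* n))
  ^ₚ-assocʳ x m n = ≃-trans (^ₚ-congˡ n (^ₚ≃^A x m)) (≃-trans (^ₚ≃^A (x ^A m) n)
    (≃-trans (SemiringExp.^-assocʳ A.semiring x m n) (≃-sym (^ₚ≃^A x (m ℕ.* n)))))

  ^ₚ-distrib-* : ∀ x y n → ((x *ₚ y) ^ₚ n) ≃ ((x ^ₚ n) *ₚ (y ^ₚ n))
  ^ₚ-distrib-* x y n = ≃-trans (^ₚ≃^A (x *ₚ y) n) (≃-trans (CommutativeSemiringExp.^-distrib-* A.commutativeSemiring x y n)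
    (*-cong (≃-sym (^ₚ≃^A x n)) (≃-sym (^ₚ≃^A y n))))

  ≃⇒≡ : ∀ {p r} → length p ≡ length r → p ≃ r → p ≡ r
  ≃⇒≡ {[]} {[]} _ _ = refl
  ≃⇒≡ {a ∷ p} {b ∷ r} |p|≡|r| (mk e) = cong₂ _∷_ (e zero) (≃⇒≡ (ℕ.suc-injective |p|≡|r|) (mk (e ∘ suc)))

  x-y≃0⇒x≃y : ∀ {x y} → (x -ₚ y) ≃ [] → x ≃ y
  x-y≃0⇒x≃y {x} {y} = RingProperties.x∙y⁻¹≈ε⇒x≈y A.ring x y

module Degrees (𝔽 : FiniteField) where
  open import Data.Nat using (_+_; _∸_)
  open FiniteField 𝔽
  open Carlitz 𝔽
  open FiniteFieldArithmetic 𝔽 using (module F; module F-Properties; *-nonzero)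
  open Polynomials 𝔽
  open A-Solver using (solve; _:=_; _:+_; _:*_; _:-_)

  -- deg p < n, as a record so that p and n can be inferred from a proof.
  record DegLt (p : Poly) (n : ℕ) : Set where
    constructor degLt
    field coeff-≥ : ∀ m → n ≤ m → coeff p m ≡ 0F
  open DegLt public

  Deg : Poly → ℕ → Set
  Deg p d = (coeff p d ≢ 0F) × DegLt p (suc d)

  DegLt-≃ : ∀ {p r n} → p ≃ r → DegLt p n → DegLt r n
  DegLt-≃ (mk e) h = degLt λ m n≤m → ≡.trans (≡.sym (e m)) (coeff-≥ h m n≤m)

  Deg-≃ : ∀ {p r d} → p ≃ r → Deg p d → Deg r d
  Deg-≃ (mk e) (top≢0 , h) = (λ z → top≢0 (≡.trans (e _) z)) , DegLt-≃ (mk e) h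

  DegLt-mono : ∀ {p n n′} → n ≤ n′ → DegLt p n → DegLt p n′
  DegLt-mono n≤n′ h = degLt λ m n′≤m → coeff-≥ h m (ℕ.≤-trans n≤n′ n′≤m)

  DegLt-length : ∀ p → DegLt p (length p)
  DegLt-length p = degLt (beyond p)
    where
    beyond : ∀ p m → length p ≤ m → coeff p m ≡ 0F
    beyond [] m _ = refl
    beyond (a ∷ p) (suc m) (s≤s le) = beyond p m le

  DegLt⇒< : ∀ {h n d} → DegLt h n → Deg h d → d < n
  DegLt⇒< {h} {n} {d} h<n (top≢0 , _) with d ℕ.<? n
  ... | yes d<n = d<n
  ... | no d≮n = ⊥-elim (top≢0 (coeff-≥ h<n d (ℕ.≮⇒≥ d≮n)))

  zero⊎Deg : ∀ p → p ≃ [] ⊎ Σ ℕ (Deg p)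
  zero⊎Deg [] = inj₁ ≃-refl
  zero⊎Deg (a ∷ p) with zero⊎Deg p
  ... | inj₂ (d , top≢0 , h) = inj₂ (suc d , top≢0 , degLt λ { (suc m) (s≤s le) → coeff-≥ h m le })
  ... | inj₁ (mk p≈0) with a ≟F 0F
  ...   | yes a≡0 = inj₁ (mk λ { zero → a≡0 ; (suc n) → p≈0 n })
  ...   | no a≢0 = inj₂ (0 , a≢0 , degLt λ { (suc m) _ → p≈0 m })

  Deg⇒≄0 : ∀ {p d} → Deg p d → ¬ (p ≃ [])
  Deg⇒≄0 (top≢0 , _) (mk e) = top≢0 (e _)

  ≄0⇒Deg : ∀ {p} → ¬ (p ≃ []) → Σ ℕ (Deg p)
  ≄0⇒Deg {p} p≄0 with zero⊎Deg p
  ... | inj₁ p≃0 = ⊥-elim (p≄0 p≃0)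
  ... | inj₂ d = d

  Deg-unique : ∀ {p d e} → Deg p d → Deg p e → d ≡ e
  Deg-unique {p} {d} {e} (top≢0 , h) (top′≢0 , h′) with ℕ.<-cmp d e
  ... | tri< d<e _ _ = ⊥-elim (top′≢0 (coeff-≥ h e d<e))
  ... | tri≈ _ d≡e _ = d≡e
  ... | tri> _ _ e<d = ⊥-elim (top≢0 (coeff-≥ h′ d e<d))

  Deg-1ₚ : Deg 1ₚ 0
  Deg-1ₚ = 1≢0 , degLt λ { (suc m) _ → refl }

  private
    Vanishes : (ℕ → F) → ℕ → Set
    Vanishes f d = ∀ m → d < m → f m ≡ 0F

    convolution-beyond : ∀ d e {f g} → Vanishes f d → Vanishes g e → Vanishes (convolution f g) (d + e)
    convolution-beyond zero e {f} {g} hf hg (suc n) lt =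
      ≡.trans (cong₂ _+F_ (≡.trans (cong (f 0 *F_) (hg (suc n) lt)) (F.zeroʳ _))
                          (≡.trans (convolution-cong (λ m → hf (suc m) (s≤s z≤n)) (λ _ → refl) n) (convolution-zeroˡ g n)))
              (F.+-identityˡ 0F)
    convolution-beyond (suc d) e {f} {g} hf hg (suc n) (s≤s lt) =
      ≡.trans (cong₂ _+F_ (≡.trans (cong (f 0 *F_) (hg (suc n) (ℕ.≤-trans (s≤s (ℕ.m≤n+m e d)) (ℕ.m≤n⇒m≤1+n lt)))) (F.zeroʳ _))
                          (convolution-beyond d e (λ m lt′ → hf (suc m) (s≤s lt′)) hg n lt))
              (F.+-identityˡ 0F)

    convolution-top : ∀ d e {f g} → Vanishes f d → Vanishes g e → convolution f g (d + e) ≡ (f d *F g e)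
    convolution-top zero zero hf hg = refl
    convolution-top zero (suc e) {f} {g} hf hg =
      ≡.trans (cong ((f 0 *F g (suc e)) +F_) (≡.trans (convolution-cong (λ m → hf (suc m) (s≤s z≤n)) (λ _ → refl) e) (convolution-zeroˡ g e)))
              (F.+-identityʳ _)
    convolution-top (suc d) e {f} {g} hf hg =
      ≡.trans (cong₂ _+F_ (≡.trans (cong (f 0 *F_) (hg (suc (d + e)) (s≤s (ℕ.m≤n+m e d)))) (F.zeroʳ _))
                          (convolution-top d e (λ m lt′ → hf (suc m) (s≤s lt′)) hg))
              (F.+-identityˡ _)

  Deg-* : ∀ {p r d e} → Deg p d → Deg r e → Deg (p *ₚ r) (d + e)
  Deg-* {p} {r} {d} {e} (top≢0 , hp) (top′≢0 , hr) =
    (λ z → *-nonzero top≢0 top′≢0 (≡.trans (≡.sym (≡.trans (coeff-* p r (d + e)) (convolution-top d e (coeff-≥ hp) (coeff-≥ hr)))) z)) ,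
    degLt λ m lt → ≡.trans (coeff-* p r m) (convolution-beyond d e (coeff-≥ hp) (coeff-≥ hr) m lt)

  DegLt-+ : ∀ {p r n} → DegLt p n → DegLt r n → DegLt (p +ₚ r) n
  DegLt-+ {p} {r} hp hr = degLt λ m le →
    ≡.trans (coeff-+ p r m) (≡.trans (cong₂ _+F_ (coeff-≥ hp m le) (coeff-≥ hr m le)) (F.+-identityˡ 0F))

  DegLt-neg : ∀ {p n} → DegLt p n → DegLt (-ₚ p) n
  DegLt-neg {p} hp = degLt λ m le →
    ≡.trans (coeff-neg p m) (≡.trans (cong -F_ (coeff-≥ hp m le)) F-Properties.-0#≈0#)

  *-≄0 : ∀ {p r} → ¬ (p ≃ []) → ¬ (r ≃ []) → ¬ ((p *ₚ r) ≃ [])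
  *-≄0 p≄0 r≄0 with ≄0⇒Deg p≄0 | ≄0⇒Deg r≄0
  ... | (d , deg-p) | (e , deg-r) = Deg⇒≄0 (Deg-* deg-p deg-r)

  *-cancelˡ : ∀ {p x y} → ¬ (p ≃ []) → (p *ₚ x) ≃ (p *ₚ y) → x ≃ y
  *-cancelˡ {p} {x} {y} p≄0 px≃py with zero⊎Deg (x -ₚ y)
  ... | inj₂ (d , deg) = ⊥-elim (*-≄0 p≄0 (Deg⇒≄0 deg) (begin
        p *ₚ (x -ₚ y)           ≈⟨ solve 3 (λ p x y → p :* (x :- y) := p :* x :- p :* y) ≃-refl p x y ⟩
        (p *ₚ x) -ₚ (p *ₚ y)    ≈⟨ +-cong px≃py ≃-refl ⟩
        (p *ₚ y) -ₚ (p *ₚ y)    ≈⟨ -‿inverseʳ (p *ₚ y) ⟩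
        []                      ∎))
    where open ≃-Reasoning
  ... | inj₁ x-y≃0 = x-y≃0⇒x≃y x-y≃0

  record DivisionResult (f p : Poly) (d : ℕ) : Set where
    constructor divisionResult
    field
      quotient remainder : Poly
      equation : p ≃ ((f *ₚ quotient) +ₚ remainder)
      remainder-DegLt : DegLt remainder d

  private
    shiftⁿ : ℕ → Poly → Poly
    shiftⁿ zero p = p
    shiftⁿ (suc k) p = shift (shiftⁿ k p)

    coeff-shiftⁿ : ∀ k p n → coeff (shiftⁿ k p) (k + n) ≡ coeff p n
    coeff-shiftⁿ zero p n = refl
    coeff-shiftⁿ (suc k) p n = coeff-shiftⁿ k p n

    shiftⁿ-* : ∀ k p r → (shiftⁿ k p *ₚ r) ≃ shiftⁿ k (p *ₚ r)
    shiftⁿ-* zero p r = ≃-refl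
    shiftⁿ-* (suc k) p r = ≃-trans (shift-* (shiftⁿ k p) r) (shift-cong (shiftⁿ-* k p r))

    shiftⁿ-cong : ∀ k {p p′} → p ≃ p′ → shiftⁿ k p ≃ shiftⁿ k p′
    shiftⁿ-cong zero e = e
    shiftⁿ-cong (suc k) e = shift-cong (shiftⁿ-cong k e)

    quotient-term : ∀ {f d} → Deg f d → ℕ → F → Poly
    quotient-term (lc≢0 , _) k c = shiftⁿ k (const (c *F proj₁ (inverse _ lc≢0)))

    -- One step of long division: if c is the coefficient of θ^M in p, then
    -- subtracting (c / lc f) θ^(M − d) f from p cancels it.
    reduce : ∀ {f d} (deg-f : Deg f d) M → d ≤ M → ∀ p → DegLt p (suc M)
           → DegLt (p -ₚ (f *ₚ quotient-term deg-f (M ∸ d) (coeff p M))) M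
    reduce {f} {d} deg-f@(lc≢0 , f<d+1) M d≤M p p<M+1 = degLt λ j M≤j → ≡.trans (coeff-+ p (-ₚ (f *ₚ m)) j)
      (≡.trans (cong (coeff p j +F_) (≡.trans (coeff-neg (f *ₚ m) j) (cong -F_ (coeff-fm j M≤j)))) (cancels j M≤j))
      where
      k = M ∸ d
      M∸k≡d : M ∸ k ≡ d
      M∸k≡d = ≡.trans (cong (_∸ k) (≡.sym (ℕ.m∸n+n≡m d≤M))) (ℕ.m+n∸m≡n k d)
      lc⁻¹ = proj₁ (inverse (coeff f d) lc≢0)
      c = coeff p M
      m = quotient-term deg-f k c
      coeff-fm : ∀ j → M ≤ j → coeff (f *ₚ m) j ≡ ((c *F lc⁻¹) *F coeff f (j ∸ k))
      coeff-fm j M≤j = begin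
        coeff (f *ₚ m) j                                          ≡⟨ coeff-≡ fm j ⟩
        coeff (shiftⁿ k (map ((c *F lc⁻¹) *F_) f)) j              ≡⟨ cong (coeff (shiftⁿ k _)) (ℕ.m+[n∸m]≡n (ℕ.≤-trans (ℕ.m∸n≤m M d) M≤j)) ⟨
        coeff (shiftⁿ k (map ((c *F lc⁻¹) *F_) f)) (k + (j ∸ k))  ≡⟨ coeff-shiftⁿ k _ (j ∸ k) ⟩
        coeff (map ((c *F lc⁻¹) *F_) f) (j ∸ k)                   ≡⟨ coeff-map (c *F lc⁻¹) f (j ∸ k) ⟩
        (c *F lc⁻¹) *F coeff f (j ∸ k)                            ∎
        where
        open ≡.≡-Reasoning
        fm : (f *ₚ m) ≃ shiftⁿ k (map ((c *F lc⁻¹) *F_) f)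
        fm = ≃-trans (*-comm f m) (≃-trans (shiftⁿ-* k (const (c *F lc⁻¹)) f) (shiftⁿ-cong k (const-*ₚ (c *F lc⁻¹) f)))
      cancels : ∀ j → M ≤ j → (coeff p j +F (-F ((c *F lc⁻¹) *F coeff f (j ∸ k)))) ≡ 0F
      cancels j M≤j with ℕ.m≤n⇒m<n∨m≡n M≤j
      ... | inj₂ refl = ≡.trans (cong (λ z → c +F (-F z)) (≡.trans (cong (λ i → (c *F lc⁻¹) *F coeff f i) M∸k≡d) leading))
                                (F.-‿inverseʳ c)
        where
        leading : ((c *F lc⁻¹) *F coeff f d) ≡ c
        leading = ≡.trans (F.*-assoc c lc⁻¹ _)
          (≡.trans (cong (c *F_) (≡.trans (F.*-comm lc⁻¹ _) (proj₂ (inverse (coeff f d) lc≢0)))) (F.*-identityʳ c))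
      ... | inj₁ M<j = ≡.trans (cong₂ (λ a b → a +F (-F ((c *F lc⁻¹) *F b))) (coeff-≥ p<M+1 j M<j) (coeff-≥ f<d+1 (j ∸ k) d<j∸k))
                               (≡.trans (cong (λ z → 0F +F (-F z)) (F.zeroʳ _)) (F.-‿inverseʳ 0F))
        where
        d<j∸k : suc d ≤ j ∸ k
        d<j∸k = ≡.subst (_≤ j ∸ k) (≡.trans (ℕ.+-∸-assoc 1 (ℕ.m∸n≤m M d)) (cong suc M∸k≡d)) (ℕ.∸-monoˡ-≤ k M<j)

  divide : ∀ {f d} → Deg f d → ∀ N p → DegLt p N → DivisionResult f p d
  divide {f} {d} deg-f N p p<N with N ℕ.≤? d
  ... | yes N≤d = divisionResult [] p (≃-sym (+-cong (*-zeroʳ f) (≃-refl {p}))) (DegLt-mono N≤d p<N)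
  divide {f} {d} deg-f zero p p<N | no N≰d = ⊥-elim (N≰d z≤n)
  divide {f} {d} deg-f (suc M) p p<N | no N≰d = divisionResult (quotient +ₚ m) remainder equation′ remainder-DegLt
    where
    m = quotient-term deg-f (M ∸ d) (coeff p M)
    open DivisionResult (divide deg-f M (p -ₚ (f *ₚ m)) (reduce deg-f M (ℕ.≤-pred (ℕ.≰⇒> N≰d)) p p<N))
    equation′ : p ≃ ((f *ₚ (quotient +ₚ m)) +ₚ remainder)
    equation′ = begin
      p                                                ≈⟨ solve 2 (λ p x → p := (p :- x) :+ x) ≃-refl p (f *ₚ m) ⟩
      (p -ₚ (f *ₚ m)) +ₚ (f *ₚ m)                      ≈⟨ +-cong equation ≃-refl ⟩
      ((f *ₚ quotient) +ₚ remainder) +ₚ (f *ₚ m)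
        ≈⟨ solve 4 (λ f q r m → (f :* q :+ r) :+ f :* m := f :* (q :+ m) :+ r) ≃-refl f quotient remainder m ⟩
      (f *ₚ (quotient +ₚ m)) +ₚ remainder              ∎
      where open ≃-Reasoning

module Divisibility (𝔽 : FiniteField) where
  open FiniteField 𝔽
  open Carlitz 𝔽
  open Polynomials 𝔽
  open A-Solver using (solve; _:=_; _:*_; :-_)

  infix 4 _∣_
  record _∣_ (a b : Poly) : Set where
    constructor divides
    field
      quotient : Poly
      equation : (a *ₚ quotient) ≃ b

  ∣-respʳ : ∀ {a b b′} → b ≃ b′ → a ∣ b → a ∣ b′
  ∣-respʳ b≃b′ (divides c ac≃b) = divides c (≃-trans ac≃b b≃b′)

  ∣-zero : ∀ {a} → a ∣ []
  ∣-zero {a} = divides [] (*-zeroʳ a)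

  ∣-*ʳ : ∀ {a b} c → a ∣ b → a ∣ (b *ₚ c)
  ∣-*ʳ {a} c (divides x ax≃b) = divides (x *ₚ c) (≃-trans (≃-sym (*-assoc a x c)) (*-cong ax≃b ≃-refl))

  ∣-*ˡ : ∀ {a b} c → a ∣ b → a ∣ (c *ₚ b)
  ∣-*ˡ {a} {b} c a∣b = ∣-respʳ (*-comm b c) (∣-*ʳ c a∣b)

  ∣-+ : ∀ {a b c} → a ∣ b → a ∣ c → a ∣ (b +ₚ c)
  ∣-+ {a} (divides x ax≃b) (divides y ay≃c) = divides (x +ₚ y) (≃-trans (*-distribˡ a x y) (+-cong ax≃b ay≃c))

  ∣-neg : ∀ {a b} → a ∣ b → a ∣ (-ₚ b)
  ∣-neg {a} (divides x ax≃b) =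
    divides (-ₚ x) (≃-trans (solve 2 (λ a x → a :* (:- x) := :- (a :* x)) ≃-refl a x) (-‿cong ax≃b))

  ∣-difference : ∀ {a b c} → a ∣ b → a ∣ c → a ∣ (b -ₚ c)
  ∣-difference a∣b a∣c = ∣-+ a∣b (∣-neg a∣c)

  ∣-*ₚ : ∀ a c → a ∣ (a *ₚ c)
  ∣-*ₚ a c = divides c ≃-refl

  ∣⇒∣ₚ : ∀ {a b} → a ∣ b → a ∣ₚ b
  ∣⇒∣ₚ (divides c ac≃b) = c , coeff-≡ ac≃b

  ∣ₚ⇒∣ : ∀ {a b} → a ∣ₚ b → a ∣ b
  ∣ₚ⇒∣ (c , ac≈b) = divides c (mk ac≈b)

module IrreducibleFactor (𝔽 : FiniteField) (v : Carlitz.Poly 𝔽) (ε : ℕ)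
         (monic : Carlitz.MonicOfDegree 𝔽 v ε) (irreducible : Carlitz.Irreducible 𝔽 v) where
  open FiniteField 𝔽
  open Carlitz 𝔽
  open FiniteFieldArithmetic 𝔽 using (module F)
  open Polynomials 𝔽
  open Degrees 𝔽
  open Divisibility 𝔽
  open A-Solver using (solve; _:=_; _:+_; _:*_; _:-_; :-_)
  open ≃-Reasoning

  Deg-v : Deg v ε
  Deg-v = (λ v_ε≡0 → 1≢0 (≡.trans (≡.sym (proj₁ monic)) v_ε≡0)) , degLt (proj₂ monic)

  v∤1 : ¬ (v ∣ 1ₚ)
  v∤1 (divides c vc≃1) = proj₁ irreducible (c , coeff-≡ vc≃1)

  1≤ε : 1 ≤ ε
  1≤ε with ε ℕ.≟ 0
  ... | no ε≢0 = ℕ.n≢0⇒n>0 ε≢0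
  ... | yes refl = ⊥-elim (v∤1 (divides (const v₀⁻¹) (≃-trans (*-comm v (const v₀⁻¹)) (≃-trans (const-*ₚ v₀⁻¹ v) (mk v₀⁻¹v≈1)))))
    where
    v₀⁻¹ = proj₁ (inverse (coeff v 0) (proj₁ Deg-v))
    v₀⁻¹v≈1 : map (v₀⁻¹ *F_) v ≈ₚ 1ₚ
    v₀⁻¹v≈1 zero = ≡.trans (coeff-map v₀⁻¹ v 0) (≡.trans (F.*-comm _ _) (proj₂ (inverse (coeff v 0) (proj₁ Deg-v))))
    v₀⁻¹v≈1 (suc n) = ≡.trans (coeff-map v₀⁻¹ v (suc n))
      (≡.trans (cong (v₀⁻¹ *F_) (coeff-≥ (proj₂ Deg-v) (suc n) (s≤s z≤n))) (F.zeroʳ v₀⁻¹))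

  ε≤Deg-multiple : ∀ {h d} → Deg h d → v ∣ h → ε ≤ d
  ε≤Deg-multiple {h} {d} deg-h (divides c vc≃h) =
    ≡.subst (ε ≤_) (Deg-unique (Deg-≃ vc≃h (Deg-* Deg-v (proj₂ deg-c))) deg-h) (ℕ.m≤m+n ε (proj₁ deg-c))
    where
    deg-c : Σ ℕ (Deg c)
    deg-c = ≄0⇒Deg λ c≃0 → Deg⇒≄0 deg-h (≃-trans (≃-sym vc≃h) (≃-trans (*-cong (≃-refl {v}) c≃0) (*-zeroʳ v)))

  DegLt-ε-multiple : ∀ {h} → DegLt h ε → v ∣ h → h ≃ []
  DegLt-ε-multiple {h} h<ε v∣h with zero⊎Deg h
  ... | inj₁ h≃0 = h≃0
  ... | inj₂ (d , deg-h) = ⊥-elim (ℕ.<⇒≱ (DegLt⇒< h<ε deg-h) (ε≤Deg-multiple deg-h v∣h))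

  v∣const⇒≡0 : ∀ {c} → v ∣ const c → c ≡ 0F
  v∣const⇒≡0 {c} v∣c = coeff-≡ (DegLt-ε-multiple const<ε v∣c) zero
    where
    const<ε : DegLt (const c) ε
    const<ε = degLt λ { zero ε≤0 → ⊥-elim (ℕ.<⇒≱ 1≤ε ε≤0) ; (suc m) _ → refl }

  v∣⊎remainder : ∀ f → v ∣ f ⊎ Σ Poly (λ r → Σ ℕ (λ d → Deg r d × d < ε × v ∣ (f -ₚ r)))
  v∣⊎remainder f with divide Deg-v (length f) f (DegLt-length f)
  ... | divisionResult t r f≃vt+r r<ε with zero⊎Deg r
  ...   | inj₁ r≃0 = inj₁ (divides t (≃-sym (≃-trans f≃vt+r (≃-trans (+-cong (≃-refl {v *ₚ t}) r≃0) (+-identityʳ _)))))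
  ...   | inj₂ (d , deg-r) = inj₂ (r , d , deg-r , DegLt⇒< r<ε deg-r , divides t (≃-sym (begin
          f -ₚ r                         ≈⟨ +-cong f≃vt+r ≃-refl ⟩
          ((v *ₚ t) +ₚ r) -ₚ r           ≈⟨ solve 3 (λ v t r → (v :* t :+ r) :- r := v :* t) ≃-refl v t r ⟩
          v *ₚ t                         ∎)))

  v∣? : ∀ f → Dec (v ∣ f)
  v∣? f with v∣⊎remainder f
  ... | inj₁ v∣f = yes v∣f
  ... | inj₂ (r , d , deg-r , d<ε , v∣f-r) = no λ v∣f →
        ℕ.<⇒≱ d<ε (ε≤Deg-multiple deg-r (∣-respʳ (solve 2 (λ f r → f :- (f :- r) := r) ≃-refl f r) (∣-difference v∣f v∣f-r)))

  private
    -- Divide v by r: v = r t + s.  If s = 0, irreducibility makes r a unit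
    -- (t cannot be one, as deg r < ε); otherwise s g = v g − t (r g) and deg s < deg r.
    euclid-descent : ∀ fuel d → d < fuel → d < ε → ∀ r g → Deg r d → v ∣ (r *ₚ g) → v ∣ g
    euclid-descent (suc fuel) d (s≤s d≤fuel) d<ε r g deg-r v∣rg with divide deg-r (suc ε) v (proj₂ Deg-v)
    ... | divisionResult t s v≃rt+s s<d with zero⊎Deg s
    ...   | inj₁ s≃0 = by-irreducibility (proj₂ irreducible r t (coeff-≡ v≃rt))
      where
      v≃rt : v ≃ (r *ₚ t)
      v≃rt = ≃-trans v≃rt+s (≃-trans (+-cong (≃-refl {r *ₚ t}) s≃0) (+-identityʳ _))
      by-irreducibility : IsUnit r ⊎ IsUnit t → v ∣ g
      by-irreducibility (inj₁ (r⁻¹ , rr⁻¹≈1)) = ∣-respʳ (begin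
        r⁻¹ *ₚ (r *ₚ g)     ≈⟨ solve 3 (λ r⁻¹ r g → r⁻¹ :* (r :* g) := (r :* r⁻¹) :* g) ≃-refl r⁻¹ r g ⟩
        (r *ₚ r⁻¹) *ₚ g     ≈⟨ *-cong (mk {r *ₚ r⁻¹} {1ₚ} rr⁻¹≈1) ≃-refl ⟩
        1ₚ *ₚ g             ≈⟨ *-identityˡ g ⟩
        g                   ∎) (∣-*ˡ r⁻¹ v∣rg)
      by-irreducibility (inj₂ (t⁻¹ , tt⁻¹≈1)) = ⊥-elim (ℕ.<⇒≱ d<ε (ε≤Deg-multiple deg-r (divides t⁻¹ (begin
        v *ₚ t⁻¹            ≈⟨ *-cong v≃rt ≃-refl ⟩
        (r *ₚ t) *ₚ t⁻¹     ≈⟨ *-assoc r t t⁻¹ ⟩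
        r *ₚ (t *ₚ t⁻¹)     ≈⟨ *-cong (≃-refl {r}) (mk {t *ₚ t⁻¹} {1ₚ} tt⁻¹≈1) ⟩
        r *ₚ 1ₚ             ≈⟨ A.*-identityʳ r ⟩
        r                   ∎))))
    euclid-descent (suc fuel) d (s≤s d≤fuel) d<ε r g deg-r v∣rg | divisionResult t s v≃rt+s s<d | inj₂ (d′ , deg-s) =
      euclid-descent fuel d′ (ℕ.<-≤-trans d′<d d≤fuel) (ℕ.<-trans d′<d d<ε) s g deg-s
        (∣-respʳ (≃-sym sg≃vg-trg) (∣-difference (∣-*ₚ v g) (∣-*ˡ t v∣rg)))
      where
      d′<d : d′ < d
      d′<d = DegLt⇒< s<d deg-s
      sg≃vg-trg : (s *ₚ g) ≃ ((v *ₚ g) -ₚ (t *ₚ (r *ₚ g)))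
      sg≃vg-trg = begin
        s *ₚ g                                ≈⟨ *-cong (solve 3 (λ s r t → s := (r :* t :+ s) :- r :* t) ≃-refl s r t) ≃-refl ⟩
        (((r *ₚ t) +ₚ s) -ₚ (r *ₚ t)) *ₚ g    ≈⟨ *-cong (+-cong (≃-sym v≃rt+s) ≃-refl) ≃-refl ⟩
        (v -ₚ (r *ₚ t)) *ₚ g                  ≈⟨ solve 4 (λ v r t g → (v :- r :* t) :* g := v :* g :- t :* (r :* g)) ≃-refl v r t g ⟩
        (v *ₚ g) -ₚ (t *ₚ (r *ₚ g))           ∎

  euclid : ∀ f g → v ∣ (f *ₚ g) → v ∣ f ⊎ v ∣ g
  euclid f g v∣fg with v∣⊎remainder f
  ... | inj₁ v∣f = inj₁ v∣f
  ... | inj₂ (r , d , deg-r , d<ε , v∣f-r) = inj₂ (euclid-descent (suc d) d ℕ.≤-refl d<ε r g deg-r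
          (∣-respʳ (solve 3 (λ f r g → f :* g :- (f :- r) :* g := r :* g) ≃-refl f r g) (∣-difference v∣fg (∣-*ʳ g v∣f-r))))

  v∣^⇒v∣ : ∀ {y} n → v ∣ (y ^ₚ n) → v ∣ y
  v∣^⇒v∣ zero v∣1 = ⊥-elim (v∤1 v∣1)
  v∣^⇒v∣ {y} (suc n) v∣yⁿ⁺¹ = [ (λ v∣y → v∣y) , v∣^⇒v∣ n ] (euclid y (y ^ₚ n) v∣yⁿ⁺¹)

  infix 4 _≡v_
  record _≡v_ (x y : Poly) : Set where
    constructor ≡v⟨_⟩
    field v∣difference : v ∣ (x -ₚ y)
  open _≡v_ public

  ≡v-refl : ∀ {x} → x ≡v x
  ≡v-refl {x} = ≡v⟨ ∣-respʳ (≃-sym (-‿inverseʳ x)) ∣-zero ⟩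

  ≃⇒≡v : ∀ {x y} → x ≃ y → x ≡v y
  ≃⇒≡v {x} {y} x≃y = ≡v⟨ ∣-respʳ (≃-sym (≃-trans (+-cong (≃-refl {x}) (-‿cong (≃-sym x≃y))) (-‿inverseʳ x))) ∣-zero ⟩

  ≡v-sym : ∀ {x y} → x ≡v y → y ≡v x
  ≡v-sym {x} {y} ≡v⟨ v∣x-y ⟩ = ≡v⟨ ∣-respʳ (solve 2 (λ x y → :- (x :- y) := y :- x) ≃-refl x y) (∣-neg v∣x-y) ⟩

  ≡v-trans : ∀ {x y z} → x ≡v y → y ≡v z → x ≡v z
  ≡v-trans {x} {y} {z} ≡v⟨ v∣x-y ⟩ ≡v⟨ v∣y-z ⟩ =
    ≡v⟨ ∣-respʳ (solve 3 (λ x y z → (x :- y) :+ (y :- z) := x :- z) ≃-refl x y z) (∣-+ v∣x-y v∣y-z) ⟩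

  ≡v-+ : ∀ {x x′ y y′} → x ≡v x′ → y ≡v y′ → (x +ₚ y) ≡v (x′ +ₚ y′)
  ≡v-+ {x} {x′} {y} {y′} ≡v⟨ v∣x-x′ ⟩ ≡v⟨ v∣y-y′ ⟩ =
    ≡v⟨ ∣-respʳ (solve 4 (λ x x′ y y′ → (x :- x′) :+ (y :- y′) := (x :+ y) :- (x′ :+ y′)) ≃-refl x x′ y y′) (∣-+ v∣x-x′ v∣y-y′) ⟩

  ≡v-* : ∀ {x x′ y y′} → x ≡v x′ → y ≡v y′ → (x *ₚ y) ≡v (x′ *ₚ y′)
  ≡v-* {x} {x′} {y} {y′} ≡v⟨ v∣x-x′ ⟩ ≡v⟨ v∣y-y′ ⟩ =
    ≡v⟨ ∣-respʳ (solve 4 (λ x x′ y y′ → (x :- x′) :* y :+ x′ :* (y :- y′) := x :* y :- x′ :* y′) ≃-refl x x′ y y′)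
                (∣-+ (∣-*ʳ y v∣x-x′) (∣-*ˡ x′ v∣y-y′)) ⟩

  ≡v-^ : ∀ {x y} n → x ≡v y → (x ^ₚ n) ≡v (y ^ₚ n)
  ≡v-^ zero _ = ≡v-refl
  ≡v-^ (suc n) x≡y = ≡v-* x≡y (≡v-^ n x≡y)

module RootCounting (𝔽 : FiniteField) (v : Carlitz.Poly 𝔽) (ε : ℕ)
         (monic : Carlitz.MonicOfDegree 𝔽 v ε) (irreducible : Carlitz.Irreducible 𝔽 v) where
  open FiniteField 𝔽
  open Carlitz 𝔽
  open Polynomials 𝔽
  open Divisibility 𝔽
  open IrreducibleFactor 𝔽 v ε monic irreducible
  open A-Solver using (solve; _:=_; _:+_; _:*_; _:-_)
  open ≃-Reasoning

  eval : List Poly → Poly → Poly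
  eval [] x = []
  eval (c ∷ cs) x = c +ₚ (x *ₚ eval cs x)

  -- The coefficients of (P(X) − P(a)) / (X − a), where P has coefficients c ∷ cs.
  dividedDifference : List Poly → Poly → List Poly
  dividedDifference [] a = []
  dividedDifference (c ∷ cs) a = eval (c ∷ cs) a ∷ dividedDifference cs a

  length-dividedDifference : ∀ cs a → length (dividedDifference cs a) ≡ length cs
  length-dividedDifference [] a = refl
  length-dividedDifference (c ∷ cs) a = cong suc (length-dividedDifference cs a)

  eval-[c] : ∀ c x → eval (c ∷ []) x ≃ c
  eval-[c] c x = ≃-trans (+-cong (≃-refl {c}) (*-zeroʳ x)) (+-identityʳ c)

  eval-difference : ∀ c cs x a → (eval (c ∷ cs) x -ₚ eval (c ∷ cs) a) ≃ ((x -ₚ a) *ₚ eval (dividedDifference cs a) x)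
  eval-difference c [] x a =
    ≃-trans (+-cong (eval-[c] c x) (-‿cong (eval-[c] c a))) (≃-trans (-‿inverseʳ c) (≃-sym (*-zeroʳ (x -ₚ a))))
  eval-difference c (c′ ∷ cs) x a = begin
    (c +ₚ (x *ₚ Pₓ)) -ₚ (c +ₚ (a *ₚ Pₐ))
      ≈⟨ solve 5 (λ c x a Pₓ Pₐ → (c :+ x :* Pₓ) :- (c :+ a :* Pₐ) := (x :- a) :* Pₐ :+ x :* (Pₓ :- Pₐ)) ≃-refl c x a Pₓ Pₐ ⟩
    ((x -ₚ a) *ₚ Pₐ) +ₚ (x *ₚ (Pₓ -ₚ Pₐ))      ≈⟨ +-cong (≃-refl {(x -ₚ a) *ₚ Pₐ}) (*-cong (≃-refl {x}) (eval-difference c′ cs x a)) ⟩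
    ((x -ₚ a) *ₚ Pₐ) +ₚ (x *ₚ ((x -ₚ a) *ₚ Q))
      ≈⟨ solve 4 (λ x a Pₐ Q → (x :- a) :* Pₐ :+ x :* ((x :- a) :* Q) := (x :- a) :* (Pₐ :+ x :* Q)) ≃-refl x a Pₐ Q ⟩
    (x -ₚ a) *ₚ (Pₐ +ₚ (x *ₚ Q))               ∎
    where
    Pₓ = eval (c′ ∷ cs) x
    Pₐ = eval (c′ ∷ cs) a
    Q = eval (dividedDifference cs a) x

  Incongruent : List Poly → Set
  Incongruent [] = ⊤
  Incongruent (a ∷ as) = All (λ b → ¬ (v ∣ (b -ₚ a))) as × Incongruent as

  All-v∣-coefficients : ∀ c cs a → All (v ∣_) (dividedDifference cs a) → v ∣ eval (c ∷ cs) a → All (v ∣_) (c ∷ cs)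
  All-v∣-coefficients c [] a _ v∣c = ∣-respʳ (eval-[c] c a) v∣c ∷ []
  All-v∣-coefficients c (c′ ∷ cs) a (v∣P′a ∷ v∣Q) v∣Pa =
    ∣-respʳ (solve 2 (λ c y → (c :+ y) :- y := c) ≃-refl c (a *ₚ eval (c′ ∷ cs) a)) (∣-difference v∣Pa (∣-*ˡ a v∣P′a))
    ∷ All-v∣-coefficients c′ cs a v∣Q v∣P′a

  root-counting : ∀ n cs → length cs ≡ n → ∀ rs → length rs ≡ n → Incongruent rs → All (λ r → v ∣ eval cs r) rs → All (v ∣_) cs
  root-counting zero [] _ _ _ _ _ = []
  root-counting (suc n) (c ∷ cs) |cs|≡n (a ∷ rs) |rs|≡n (a≢rs , incongruent) (v∣Pa ∷ v∣Prs) =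
    All-v∣-coefficients c cs a
      (root-counting n (dividedDifference cs a) (≡.trans (length-dividedDifference cs a) (ℕ.suc-injective |cs|≡n))
                     rs (ℕ.suc-injective |rs|≡n) incongruent (roots-of-quotient rs a≢rs v∣Prs))
      v∣Pa
    where
    roots-of-quotient : ∀ bs → All (λ b → ¬ (v ∣ (b -ₚ a))) bs → All (λ r → v ∣ eval (c ∷ cs) r) bs
                      → All (λ r → v ∣ eval (dividedDifference cs a) r) bs
    roots-of-quotient [] _ _ = []
    roots-of-quotient (b ∷ bs) (b≢a ∷ bs≢a) (v∣Pb ∷ v∣Pbs) =
      [ (λ v∣b-a → ⊥-elim (b≢a v∣b-a)) , (λ v∣Qb → v∣Qb) ]
        (euclid (b -ₚ a) (eval (dividedDifference cs a) b) (∣-respʳ (eval-difference c cs b a) (∣-difference v∣Pb v∣Pa)))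
      ∷ roots-of-quotient bs bs≢a v∣Pbs

module BinomialCoefficients (𝔽 : FiniteField) (v : Carlitz.Poly 𝔽) (ε : ℕ)
         (monic : Carlitz.MonicOfDegree 𝔽 v ε) (irreducible : Carlitz.Irreducible 𝔽 v) where
  open import Data.Nat using (_∸_)
  open ≡.≡-Reasoning
  open FiniteField 𝔽
  open Carlitz 𝔽
  open FiniteFieldArithmetic 𝔽
  open Polynomials 𝔽
  open Divisibility 𝔽
  open IrreducibleFactor 𝔽 v ε monic irreducible
  open RootCounting 𝔽 v ε monic irreducible
  module ΣF = MonoidSum F.+-monoid
  open ΣF using (sum-syntax; sum⁺-syntax)

  value : ∀ {n} → (Fin n → F) → F → F
  value {n} f b = ∑[ i < n ] (f i *F (b ^F toℕ i))

  private
    value-suc : ∀ {n} (f : Fin (suc n) → F) b → value f b ≡ (f zero +F (b *F value (f ∘ suc) b))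
    value-suc {n} f b = cong₂ _+F_ (F.*-identityʳ (f zero)) (begin
      ∑[ i < n ] (f (suc i) *F (b *F (b ^F toℕ i)))
        ≡⟨ ΣF.sum-cong-≗ (λ i → solve 3 (λ x y z → x :* (y :* z) := y :* (x :* z)) refl (f (suc i)) b _) ⟩
      ∑[ i < n ] (b *F (f (suc i) *F (b ^F toℕ i)))   ≡⟨ SemiringSum.*-distribˡ-sum F.semiring b (λ i → f (suc i) *F (b ^F toℕ i)) ⟨
      b *F value (f ∘ suc) b                          ∎)
      where open F-Solver using (solve; _:=_; _:*_)

    eval-constants : ∀ {n} (f : Fin n → F) b → eval (tabulate (const ∘ f)) (const b) ≃ const (value f b)
    eval-constants {zero} f b = ≃-sym const-0
    eval-constants {suc n} f b = ≃-trans (+-cong (≃-refl {const (f zero)})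
      (≃-trans (*-cong (≃-refl {const b}) (eval-constants (f ∘ suc) b)) (const-* b _))) (const-cong (≡.sym (value-suc f b)))

    constants-incongruent : ∀ {n} (e : Fin n → F) → Injective _≡_ _≡_ e → Incongruent (tabulate (const ∘ e))
    constants-incongruent {zero} e e-inj = tt
    constants-incongruent {suc n} e e-inj =
      All.tabulate⁺ (λ j v∣eⱼ-e₀ → Fin.0≢1+n (≡.sym (e-inj (F-Properties.x∙y⁻¹≈ε⇒x≈y _ _ (v∣const⇒≡0 v∣eⱼ-e₀))))) ,
      constants-incongruent (e ∘ suc) (Fin.suc-injective ∘ e-inj)

  -- Root counting modulo v, applied to constant polynomials.
  vanishing-on-F : (f : Fin q → F) → (∀ b → value f b ≡ 0F) → ∀ i → f i ≡ 0F
  vanishing-on-F f f≡0 i = v∣const⇒≡0 (All.tabulate⁻ {f = const ∘ f} v∣coefficients i)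
    where
    v∣coefficients : All (v ∣_) (tabulate (const ∘ f))
    v∣coefficients = root-counting q (tabulate (const ∘ f)) (List.length-tabulate _) (tabulate (const ∘ element)) (List.length-tabulate _)
      (constants-incongruent element element-injective)
      (All.tabulate⁺ λ j → ∣-respʳ (≃-sym (≃-trans (eval-constants f (element j)) (≃-trans (const-cong (f≡0 (element j))) const-0))) ∣-zero)

  private
    1^F : ∀ n → (1F ^F n) ≡ 1F
    1^F zero = refl
    1^F (suc n) = ≡.trans (F.*-identityˡ _) (1^F n)

  -- From (b + 1)^q = b + 1 and b^q = b.
  binomial-sum : ∀ b → value {q} (λ k → (q C toℕ k) ×F 1F) b ≡ 1F
  binomial-sum b = F-Properties.+-cancelʳ b _ _ (begin
    value {q} (λ k → (q C toℕ k) ×F 1F) b +F b           ≡⟨ cong₂ _+F_ (ΣF.sum-cong-≗ initial-term) (≡.trans (≡.sym (fermat b)) (≡.sym last-term)) ⟩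
    (∑[ k < q ] term (inject₁ k)) +F term (fromℕ q)  ≡⟨ ΣF.sum-init-last term ⟨
    ∑[ k ≤ q ] term k                                 ≡⟨ Binomial.theorem F.commutativeSemiring q b 1F ⟨
    (b +F 1F) ^F q                                    ≡⟨ fermat (b +F 1F) ⟩
    b +F 1F                                           ≡⟨ F.+-comm b 1F ⟩
    1F +F b                                           ∎)
    where
    term : Fin (suc q) → F
    term k = (q C toℕ k) ×F ((b ^F toℕ k) *F (1F ^F (q ∸ toℕ k)))
    term-≡ : ∀ k → term k ≡ ((q C toℕ k) ×F 1F) *F (b ^F toℕ k)
    term-≡ k = ≡.trans (cong ((q C toℕ k) ×F_) (≡.trans (cong ((b ^F toℕ k) *F_) (1^F (q ∸ toℕ k))) (F.*-identityʳ _)))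
                       (×F-1 (q C toℕ k) (b ^F toℕ k))
    initial-term : ∀ (k : Fin q) → (((q C toℕ k) ×F 1F) *F (b ^F toℕ k)) ≡ term (inject₁ k)
    initial-term k = ≡.trans (cong (λ i → ((q C i) ×F 1F) *F (b ^F i)) (≡.sym (Fin.toℕ-inject₁ k))) (≡.sym (term-≡ (inject₁ k)))
    last-term : term (fromℕ q) ≡ (b ^F q)
    last-term = begin
      term (fromℕ q)                       ≡⟨ term-≡ (fromℕ q) ⟩
      ((q C toℕ (fromℕ q)) ×F 1F) *F (b ^F toℕ (fromℕ q)) ≡⟨ cong (λ i → ((q C i) ×F 1F) *F (b ^F i)) (Fin.toℕ-fromℕ q) ⟩
      ((q C q) ×F 1F) *F (b ^F q)          ≡⟨ cong (λ n → (n ×F 1F) *F (b ^F q)) (nCn≡1 q) ⟩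
      (1F +F 0F) *F (b ^F q)               ≡⟨ cong (_*F (b ^F q)) (F.+-identityʳ 1F) ⟩
      1F *F (b ^F q)                       ≡⟨ F.*-identityˡ _ ⟩
      b ^F q                               ∎

  private
    minus-one-at-zero : ℕ → F
    minus-one-at-zero zero = -F 1F
    minus-one-at-zero (suc _) = 0F

    value-minus-one-at-zero : ∀ n → 1 ≤ n → ∀ b → value (λ (i : Fin n) → minus-one-at-zero (toℕ i)) b ≡ (-F 1F)
    value-minus-one-at-zero (suc n) _ b = begin
      value (λ (i : Fin (suc n)) → minus-one-at-zero (toℕ i)) b   ≡⟨ value-suc {n} (λ i → minus-one-at-zero (toℕ i)) b ⟩
      (-F 1F) +F (b *F (∑[ i < n ] (0F *F (b ^F toℕ i))))
        ≡⟨ cong (λ x → (-F 1F) +F (b *F x)) (ΣF.sum-cong-≗ {n} (λ i → F.zeroˡ (b ^F toℕ i))) ⟩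
      (-F 1F) +F (b *F (∑[ i < n ] 0F))                          ≡⟨ cong (λ x → (-F 1F) +F (b *F x)) (ΣF.sum-replicate-zero n) ⟩
      (-F 1F) +F (b *F 0F)                                       ≡⟨ cong ((-F 1F) +F_) (F.zeroʳ b) ⟩
      (-F 1F) +F 0F                                              ≡⟨ F.+-identityʳ _ ⟩
      -F 1F                                                      ∎

  -- C(q,k) for 0 < k < q is a coefficient of Σ_{k<q} C(q,k) X^k − 1, which vanishes on F.
  binomial-vanishes : ∀ k → 1 ≤ k → k < q → ((q C k) ×F 1F) ≡ 0F
  binomial-vanishes k 1≤k k<q = begin
    (q C k) ×F 1F                                  ≡⟨ F.+-identityʳ _ ⟨
    ((q C k) ×F 1F) +F 0F                          ≡⟨ cong (((q C k) ×F 1F) +F_) (minus-one-at-zero≡0 k 1≤k) ⟨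
    coefficient k                                  ≡⟨ cong coefficient (Fin.toℕ-fromℕ< k<q) ⟨
    coefficient (toℕ (fromℕ< k<q))                 ≡⟨ vanishing-on-F (coefficient ∘ toℕ) vanishes (fromℕ< k<q) ⟩
    0F                                             ∎
    where
    minus-one-at-zero≡0 : ∀ k → 1 ≤ k → minus-one-at-zero k ≡ 0F
    minus-one-at-zero≡0 (suc _) _ = refl
    coefficient : ℕ → F
    coefficient i = ((q C i) ×F 1F) +F minus-one-at-zero i
    vanishes : ∀ b → value {q} (λ i → coefficient (toℕ i)) b ≡ 0F
    vanishes b = begin
      value {q} (λ i → coefficient (toℕ i)) b
        ≡⟨ ΣF.sum-cong-≗ {q} (λ i → F.distribʳ (b ^F toℕ i) ((q C toℕ i) ×F 1F) (minus-one-at-zero (toℕ i))) ⟩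
      ∑[ i < q ] ((((q C toℕ i) ×F 1F) *F (b ^F toℕ i)) +F (minus-one-at-zero (toℕ i) *F (b ^F toℕ i)))
        ≡⟨ Σ+.∑-distrib-+ {q} (λ i → ((q C toℕ i) ×F 1F) *F (b ^F toℕ i)) (λ i → minus-one-at-zero (toℕ i) *F (b ^F toℕ i)) ⟩
      value {q} (λ i → (q C toℕ i) ×F 1F) b +F value {q} (λ i → minus-one-at-zero (toℕ i)) b
        ≡⟨ cong₂ _+F_ (binomial-sum b) (value-minus-one-at-zero q 1≤q b) ⟩
      1F +F (-F 1F)
        ≡⟨ F.-‿inverseʳ 1F ⟩
      0F ∎
      where module Σ+ = CommutativeMonoidSum F.+-commutativeMonoid

  q×1≡0 : (q ×F 1F) ≡ 0F
  q×1≡0 = ≡.trans (cong (_×F 1F) (≡.sym (nC1≡n q))) (binomial-vanishes 1 (s≤s z≤n) 2≤q)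

module Frobenius (𝔽 : FiniteField) (v : Carlitz.Poly 𝔽) (ε : ℕ)
         (monic : Carlitz.MonicOfDegree 𝔽 v ε) (irreducible : Carlitz.Irreducible 𝔽 v) where
  open import Data.Nat using (_∸_)
  open FiniteField 𝔽
  open Carlitz 𝔽
  open FiniteFieldArithmetic 𝔽
  open Polynomials 𝔽
  open BinomialCoefficients 𝔽 v ε monic irreducible
  open Divisibility 𝔽 using (_∣_; ∣-*ₚ)

  open SemiringMult A.semiring using () renaming (_×_ to _×A_)
  module ΣA = MonoidSum A.+-monoid
  open SemiringExp A.semiring using () renaming (_^_ to _^A_)
  open ≃-Reasoning

  private
    ×A-vanishes : ∀ n z → (n ×F 1F) ≡ 0F → (n ×A z) ≃ []
    ×A-vanishes n z n·1≡0 = ≃-trans (×A-≃ n) (≃-trans (*-cong (≃-trans (const-cong n·1≡0) const-0) (≃-refl {z})) ≃-refl)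
      where
      ×A-≃ : ∀ n → (n ×A z) ≃ (const (n ×F 1F) *ₚ z)
      ×A-≃ zero = ≃-sym (*-cong const-0 (≃-refl {z}))
      ×A-≃ (suc n) = ≃-trans (+-cong (≃-sym (*-identityˡ z)) (×A-≃ n)) (≃-sym (*-distribʳ 1ₚ (const (n ×F 1F)) z))

    sum-vanishes : ∀ m (f : Fin m → Poly) → (∀ i → f i ≃ []) → ΣA.sum f ≃ []
    sum-vanishes zero f _ = ≃-refl
    sum-vanishes (suc m) f f≃0 = +-cong (f≃0 zero) (sum-vanishes m (f ∘ suc) (f≃0 ∘ suc))

    freshman : ∀ N → 2 ≤ N → (∀ k → 1 ≤ k → k < N → ((N C k) ×F 1F) ≡ 0F) → ∀ x y → ((x +ₚ y) ^ₚ N) ≃ ((x ^ₚ N) +ₚ (y ^ₚ N))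
    freshman (suc zero) (s≤s ()) _ _ _
    freshman N@(suc (suc m)) _ inner≡0 x y = begin
      (x +ₚ y) ^ₚ N                                                            ≈⟨ ^ₚ≃^A (x +ₚ y) N ⟩
      (x +ₚ y) ^A N                                                            ≈⟨ Binomial.theorem A.commutativeSemiring N x y ⟩
      ΣA.sum term                                                              ≈⟨ +-cong (≃-refl {term zero}) (ΣA.sum-init-last (term ∘ suc)) ⟩
      term zero +ₚ (ΣA.sum (λ j → term (suc (inject₁ j))) +ₚ term (suc (fromℕ (suc m))))
                                                                               ≈⟨ +-cong first-term (+-cong (sum-vanishes (suc m) _ inner-term) last-term) ⟩
      (y ^ₚ N) +ₚ ([] +ₚ (x ^ₚ N))                                             ≈⟨ +-comm (y ^ₚ N) (x ^ₚ N) ⟩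
      (x ^ₚ N) +ₚ (y ^ₚ N)                                                     ∎
      where
      term : Fin (suc N) → Poly
      term k = (N C toℕ k) ×A ((x ^A toℕ k) *ₚ (y ^A (N ∸ toℕ k)))
      first-term : term zero ≃ (y ^ₚ N)
      first-term = ≃-trans (+-identityʳ _) (≃-trans (*-identityˡ (y ^A N)) (≃-sym (^ₚ≃^A y N)))
      last-term : term (suc (fromℕ (suc m))) ≃ (x ^ₚ N)
      last-term = begin
        term (suc (fromℕ (suc m)))                   ≡⟨ cong (λ i → (N C i) ×A ((x ^A i) *ₚ (y ^A (N ∸ i)))) (cong suc (Fin.toℕ-fromℕ (suc m))) ⟩
        (N C N) ×A ((x ^A N) *ₚ (y ^A (N ∸ N)))      ≡⟨ cong (λ c → c ×A ((x ^A N) *ₚ (y ^A (N ∸ N)))) (nCn≡1 N) ⟩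
        ((x ^A N) *ₚ (y ^A (N ∸ N))) +ₚ []           ≈⟨ +-identityʳ _ ⟩
        (x ^A N) *ₚ (y ^A (N ∸ N))                   ≡⟨ cong (λ i → (x ^A N) *ₚ (y ^A i)) (ℕ.n∸n≡0 N) ⟩
        (x ^A N) *ₚ 1ₚ                               ≈⟨ A.*-identityʳ _ ⟩
        x ^A N                                       ≈⟨ ^ₚ≃^A x N ⟨
        x ^ₚ N                                       ∎
      inner-term : ∀ j → term (suc (inject₁ j)) ≃ []
      inner-term j = ×A-vanishes (N C toℕ (suc (inject₁ j))) _ (inner≡0 (suc (toℕ (inject₁ j))) (s≤s z≤n) (s≤s j<m+1))
        where
        j<m+1 : toℕ (inject₁ j) < suc m
        j<m+1 = ≡.subst (_< suc m) (≡.sym (Fin.toℕ-inject₁ j)) (Fin.toℕ<n j)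

  frobenius-+ : ∀ x y → ((x +ₚ y) ^ₚ q) ≃ ((x ^ₚ q) +ₚ (y ^ₚ q))
  frobenius-+ = freshman q 2≤q binomial-vanishes

  const-^ₚ : ∀ a n → (const a ^ₚ n) ≃ const (a ^F n)
  const-^ₚ a zero = ≃-refl
  const-^ₚ a (suc n) = ≃-trans (*-cong (≃-refl {const a}) (const-^ₚ a n)) (const-* a (a ^F n))

  φ : ℕ → Poly → Poly
  φ m x = x ^ₚ (q ℕ.^ m)

  φ-suc : ∀ m x → φ (suc m) x ≃ φ m (x ^ₚ q)
  φ-suc m x = ≃-sym (^ₚ-assocʳ x q (q ℕ.^ m))

  φ-cong : ∀ m {x y} → x ≃ y → φ m x ≃ φ m y
  φ-cong m = ^ₚ-congˡ (q ℕ.^ m)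

  φ-+ : ∀ m x y → φ m (x +ₚ y) ≃ (φ m x +ₚ φ m y)
  φ-+ zero x y = ≃-trans (A.*-identityʳ (x +ₚ y)) (+-cong (≃-sym (A.*-identityʳ x)) (≃-sym (A.*-identityʳ y)))
  φ-+ (suc m) x y = begin
    φ (suc m) (x +ₚ y)           ≈⟨ φ-suc m (x +ₚ y) ⟩
    φ m ((x +ₚ y) ^ₚ q)          ≈⟨ φ-cong m (frobenius-+ x y) ⟩
    φ m ((x ^ₚ q) +ₚ (y ^ₚ q))   ≈⟨ φ-+ m (x ^ₚ q) (y ^ₚ q) ⟩
    φ m (x ^ₚ q) +ₚ φ m (y ^ₚ q) ≈⟨ +-cong (φ-suc m x) (φ-suc m y) ⟨
    φ (suc m) x +ₚ φ (suc m) y   ∎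

  φ-* : ∀ m x y → φ m (x *ₚ y) ≃ (φ m x *ₚ φ m y)
  φ-* m x y = ^ₚ-distrib-* x y (q ℕ.^ m)

  φ-const : ∀ m a → φ m (const a) ≃ const a
  φ-const zero a = A.*-identityʳ (const a)
  φ-const (suc m) a = ≃-trans (φ-suc m (const a)) (≃-trans (φ-cong m (≃-trans (const-^ₚ a q) (const-cong (fermat a)))) (φ-const m a))

  φ-[] : ∀ m → φ m [] ≃ []
  φ-[] m with q ℕ.^ m | ℕ.m^n>0 q {{ℕ.>-nonZero 1≤q}} m
  ... | suc _ | _ = ≃-refl

  φ-difference : ∀ m x y → φ m (x -ₚ y) ≃ (φ m x -ₚ φ m y)
  φ-difference m x y = ≃-trans (φ-+ m x (-ₚ y)) (+-cong (≃-refl {φ m x}) φ-neg)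
    where
    open A-Solver using (solve; _:=_; _:+_; _:-_)
    φ-neg : φ m (-ₚ y) ≃ (-ₚ φ m y)
    φ-neg = begin
      φ m (-ₚ y)                         ≈⟨ solve 2 (λ a b → a := (a :+ b) :- b) ≃-refl (φ m (-ₚ y)) (φ m y) ⟩
      (φ m (-ₚ y) +ₚ φ m y) -ₚ φ m y     ≈⟨ +-cong (≃-sym (φ-+ m (-ₚ y) y)) ≃-refl ⟩
      φ m ((-ₚ y) +ₚ y) -ₚ φ m y         ≈⟨ +-cong (≃-trans (φ-cong m (-‿inverseˡ y)) (φ-[] m)) ≃-refl ⟩
      -ₚ φ m y                           ∎

  φ-φ : ∀ a b x → φ a (φ b x) ≃ φ (b ℕ.+ a) x
  φ-φ a b x = ≃-trans (^ₚ-assocʳ x (q ℕ.^ b) (q ℕ.^ a)) (^ₚ-congʳ x (≡.sym (ℕ.^-distribˡ-+-* q b a)))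

  ∣-φ : ∀ m x → x ∣ φ m x
  ∣-φ m x with q ℕ.^ m | ℕ.m^n>0 q {{ℕ.>-nonZero 1≤q}} m
  ... | suc _ | _ = ∣-*ₚ x _

module Derivative (𝔽 : FiniteField) where
  open FiniteField 𝔽
  open Carlitz 𝔽
  open FiniteFieldArithmetic 𝔽 using (module F; module F-Solver; _×F_; ×F-1)
  open Polynomials 𝔽

  der : Poly → Poly
  der [] = []
  der (a ∷ p) = p +ₚ shift (der p)

  private
    ×F-0 : ∀ n → (n ×F 0F) ≡ 0F
    ×F-0 zero = refl
    ×F-0 (suc n) = ≡.trans (F.+-identityˡ _) (×F-0 n)

  coeff-der : ∀ p n → coeff (der p) n ≡ (suc n ×F coeff p (suc n))
  coeff-der [] n = ≡.sym (≡.trans (F.+-identityˡ _) (×F-0 n))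
  coeff-der (a ∷ p) zero = coeff-+ p (shift (der p)) 0
  coeff-der (a ∷ p) (suc n) = ≡.trans (coeff-+ p (shift (der p)) (suc n)) (cong (coeff p (suc n) +F_) (coeff-der p n))

  private
    coeff-der′ : ∀ p n → coeff (der p) n ≡ ((suc n ×F 1F) *F coeff p (suc n))
    coeff-der′ p n = ≡.trans (coeff-der p n) (×F-1 (suc n) _)

  der-cong : ∀ {p r} → p ≃ r → der p ≃ der r
  der-cong {p} {r} (mk e) = mk λ n → ≡.trans (coeff-der p n) (≡.trans (cong (suc n ×F_) (e (suc n))) (≡.sym (coeff-der r n)))

  der-+ : ∀ p r → der (p +ₚ r) ≃ (der p +ₚ der r)
  der-+ p r = mk λ n → begin
    coeff (der (p +ₚ r)) n                                                  ≡⟨ coeff-der′ (p +ₚ r) n ⟩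
    c n *F coeff (p +ₚ r) (suc n)                                           ≡⟨ cong (c n *F_) (coeff-+ p r (suc n)) ⟩
    c n *F (coeff p (suc n) +F coeff r (suc n))                             ≡⟨ F.distribˡ _ _ _ ⟩
    (c n *F coeff p (suc n)) +F (c n *F coeff r (suc n))                    ≡⟨ cong₂ _+F_ (coeff-der′ p n) (coeff-der′ r n) ⟨
    coeff (der p) n +F coeff (der r) n                                      ≡⟨ coeff-+ (der p) (der r) n ⟨
    coeff (der p +ₚ der r) n                                                ∎
    where
    open ≡.≡-Reasoning
    c : ℕ → F
    c n = suc n ×F 1F

  der-neg : ∀ p → der (-ₚ p) ≃ (-ₚ der p)
  der-neg p = mk λ n → begin
    coeff (der (-ₚ p)) n                          ≡⟨ coeff-der′ (-ₚ p) n ⟩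
    (suc n ×F 1F) *F coeff (-ₚ p) (suc n)         ≡⟨ cong (_ *F_) (coeff-neg p (suc n)) ⟩
    (suc n ×F 1F) *F (-F coeff p (suc n))         ≡⟨ solve 2 (λ a b → :- (a :* b) := a :* (:- b)) refl _ _ ⟨
    -F ((suc n ×F 1F) *F coeff p (suc n))         ≡⟨ cong -F_ (coeff-der′ p n) ⟨
    -F coeff (der p) n                            ≡⟨ coeff-neg (der p) n ⟨
    coeff (-ₚ der p) n                            ∎
    where
    open ≡.≡-Reasoning
    open F-Solver using (solve; _:=_; _:*_; :-_)

  der-map : ∀ a p → der (map (a *F_) p) ≃ (const a *ₚ der p)
  der-map a p = ≃-trans (mk λ n → begin
    coeff (der (map (a *F_) p)) n                 ≡⟨ coeff-der′ (map (a *F_) p) n ⟩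
    (suc n ×F 1F) *F coeff (map (a *F_) p) (suc n) ≡⟨ cong (_ *F_) (coeff-map a p (suc n)) ⟩
    (suc n ×F 1F) *F (a *F coeff p (suc n))       ≡⟨ solve 3 (λ c a x → c :* (a :* x) := a :* (c :* x)) refl _ a _ ⟩
    a *F ((suc n ×F 1F) *F coeff p (suc n))       ≡⟨ cong (a *F_) (coeff-der′ p n) ⟨
    a *F coeff (der p) n                          ≡⟨ coeff-map a (der p) n ⟨
    coeff (map (a *F_) (der p)) n                 ∎) (≃-sym (const-*ₚ a (der p)))
    where
    open ≡.≡-Reasoning
    open F-Solver using (solve; _:=_; _:*_)

  der-* : ∀ p r → der (p *ₚ r) ≃ ((der p *ₚ r) +ₚ (p *ₚ der r))
  der-* [] r = ≃-sym (≃-trans (+-cong (≃-refl {[] *ₚ r}) (*-zeroʳ [])) (+-identityʳ []))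
  der-* (a ∷ p) r = begin
    der (map (a *F_) r +ₚ shift (p *ₚ r))                                      ≈⟨ der-+ (map (a *F_) r) (shift (p *ₚ r)) ⟩
    der (map (a *F_) r) +ₚ der (shift (p *ₚ r))
      ≈⟨ +-cong (der-map a r) (+-cong (≃-refl {p *ₚ r}) (≃-trans (shift-cong (der-* p r)) (≃-sym (θ-*ₚ _)))) ⟩
    (const a *ₚ der r) +ₚ ((p *ₚ r) +ₚ (θ *ₚ ((der p *ₚ r) +ₚ (p *ₚ der r))))
      ≈⟨ solve 6 (λ A P R P′ R′ T → (A :* R′) :+ ((P :* R) :+ (T :* ((P′ :* R) :+ (P :* R′))))
                    := ((P :+ (T :* P′)) :* R) :+ ((A :+ (T :* P)) :* R′)) ≃-refl (const a) p r (der p) (der r) θ ⟩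
    ((p +ₚ (θ *ₚ der p)) *ₚ r) +ₚ ((const a +ₚ (θ *ₚ p)) *ₚ der r)
      ≈⟨ +-cong (*-cong (+-cong (≃-refl {p}) (θ-*ₚ (der p))) ≃-refl) (*-cong (≃-sym (∷-≃ a p)) ≃-refl) ⟩
    (der (a ∷ p) *ₚ r) +ₚ ((a ∷ p) *ₚ der r)                                   ∎
    where
    open ≃-Reasoning
    open A-Solver using (solve; _:=_; _:+_; _:*_)

  der-^ₚ : ∀ g n → der (g ^ₚ suc n) ≃ (const (suc n ×F 1F) *ₚ ((g ^ₚ n) *ₚ der g))
  der-^ₚ g zero = begin
    der (g *ₚ 1ₚ)                        ≈⟨ der-* g 1ₚ ⟩
    (der g *ₚ 1ₚ) +ₚ (g *ₚ der 1ₚ)       ≈⟨ +-cong (≃-refl {der g *ₚ 1ₚ}) (≃-trans (*-cong (≃-refl {g}) shift-[]) (*-zeroʳ g)) ⟩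
    (der g *ₚ 1ₚ) +ₚ []                  ≈⟨ solve 1 (λ d → d :* con (1 , 0) :+ con (0 , 0) := con (1 , 0) :* (con (1 , 0) :* d)) ≃-refl (der g) ⟩
    1ₚ *ₚ (1ₚ *ₚ der g)                  ≈⟨ *-cong (const-cong (≡.sym (F.+-identityʳ 1F))) ≃-refl ⟩
    const (1 ×F 1F) *ₚ ((g ^ₚ 0) *ₚ der g) ∎
    where
    open ≃-Reasoning
    open A-Solver using (solve; _:=_; _:+_; _:*_; con)
  der-^ₚ g (suc n) = begin
    der (g *ₚ (g ^ₚ suc n))                                              ≈⟨ der-* g (g ^ₚ suc n) ⟩
    (der g *ₚ (g ^ₚ suc n)) +ₚ (g *ₚ der (g ^ₚ suc n))                   ≈⟨ +-cong ≃-refl (*-cong (≃-refl {g}) (der-^ₚ g n)) ⟩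
    (der g *ₚ (g *ₚ (g ^ₚ n))) +ₚ (g *ₚ (c *ₚ ((g ^ₚ n) *ₚ der g)))
      ≈⟨ solve 4 (λ g′ g G c → g′ :* (g :* G) :+ g :* (c :* (G :* g′)) := (con (1 , 0) :+ c) :* ((g :* G) :* g′)) ≃-refl (der g) g (g ^ₚ n) c ⟩
    (1ₚ +ₚ c) *ₚ ((g *ₚ (g ^ₚ n)) *ₚ der g)                              ≈⟨ ≃-refl ⟩
    const (suc (suc n) ×F 1F) *ₚ ((g ^ₚ suc n) *ₚ der g)                 ∎
    where
    c = const (suc n ×F 1F)
    open ≃-Reasoning
    open A-Solver using (solve; _:=_; _:+_; _:*_; con)

  der-θ : der θ ≃ 1ₚ
  der-θ = mk λ { zero → F.+-identityʳ 1F ; (suc zero) → refl ; (suc (suc n)) → refl }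

module CarlitzBrackets (𝔽 : FiniteField) (v : Carlitz.Poly 𝔽) (ε : ℕ)
         (monic : Carlitz.MonicOfDegree 𝔽 v ε) (irreducible : Carlitz.Irreducible 𝔽 v) where
  open import Data.Nat using (_+_; _∸_; _*_)
  open FiniteField 𝔽
  open Carlitz 𝔽
  open FiniteFieldArithmetic 𝔽 using (2≤q; 1≤q; element; element-injective; _×F_)
  open Polynomials 𝔽
  open Degrees 𝔽
  open Divisibility 𝔽
  open IrreducibleFactor 𝔽 v ε monic irreducible
  open RootCounting 𝔽 v ε monic irreducible
  open BinomialCoefficients 𝔽 v ε monic irreducible using (q×1≡0)
  open Frobenius 𝔽 v ε monic irreducible
  open Derivative 𝔽
  open A-Solver using (solve; _:=_; _:+_; _:*_; _:-_; :-_; con)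
  open ≃-Reasoning

  -- [m] = t m − θ
  t : ℕ → Poly
  t m = φ m θ

  -- φ m is a ring endomorphism fixing F, so it is the identity modulo v once it fixes θ.
  φ-≡v-id : ∀ m → v ∣ br m → ∀ x → φ m x ≡v x
  φ-≡v-id m v∣[m] [] = ≃⇒≡v (φ-[] m)
  φ-≡v-id m v∣[m] (c ∷ x) =
    ≡v-trans (≃⇒≡v φ-expand)
      (≡v-trans (≡v-+ (≡v-refl {const c}) (≡v-* {t m} {θ} ≡v⟨ v∣[m] ⟩ (φ-≡v-id m v∣[m] x))) (≃⇒≡v (≃-sym (∷-≃ c x))))
    where
    φ-expand : φ m (c ∷ x) ≃ (const c +ₚ (t m *ₚ φ m x))
    φ-expand = begin
      φ m (c ∷ x)                       ≈⟨ φ-cong m (∷-≃ c x) ⟩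
      φ m (const c +ₚ (θ *ₚ x))         ≈⟨ φ-+ m (const c) (θ *ₚ x) ⟩
      φ m (const c) +ₚ φ m (θ *ₚ x)     ≈⟨ +-cong (φ-const m c) (φ-* m θ x) ⟩
      const c +ₚ (t m *ₚ φ m x)         ∎

  private
    monomial : ℕ → List Poly
    monomial zero = 1ₚ ∷ []
    monomial (suc M) = [] ∷ monomial M

    length-monomial : ∀ M → length (monomial M) ≡ suc M
    length-monomial zero = refl
    length-monomial (suc M) = cong suc (length-monomial M)

    eval-monomial : ∀ M x → eval (monomial M) x ≃ (x ^ₚ M)
    eval-monomial zero x = eval-[c] 1ₚ x
    eval-monomial (suc M) x = *-cong (≃-refl {x}) (eval-monomial M x)

    X^-X : ℕ → List Poly
    X^-X M = [] ∷ (-ₚ 1ₚ) ∷ monomial M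

    eval-X^-X : ∀ M x → eval (X^-X M) x ≃ ((x ^ₚ suc (suc M)) -ₚ x)
    eval-X^-X M x = begin
      [] +ₚ (x *ₚ ((-ₚ 1ₚ) +ₚ (x *ₚ eval (monomial M) x))) ≈⟨ *-cong (≃-refl {x}) (+-cong ≃-refl (*-cong (≃-refl {x}) (eval-monomial M x))) ⟩
      x *ₚ ((-ₚ 1ₚ) +ₚ (x *ₚ (x ^ₚ M)))
        ≈⟨ solve 2 (λ x y → x :* ((:- con (1 , 0)) :+ x :* y) := x :* (x :* y) :- x) ≃-refl x (x ^ₚ M) ⟩
      (x *ₚ (x *ₚ (x ^ₚ M))) -ₚ x                           ∎

    v∣monomial⇒v∣1 : ∀ M → All (v ∣_) (monomial M) → v ∣ 1ₚ
    v∣monomial⇒v∣1 zero (v∣1 ∷ []) = v∣1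
    v∣monomial⇒v∣1 (suc M) (_ ∷ v∣cs) = v∣monomial⇒v∣1 M v∣cs

    -- the q^n polynomials of degree < n, by their lists of coefficients
    residue : ∀ n → Fin (q ℕ.^ n) → List F
    residue zero _ = []
    residue (suc n) i = element (proj₁ (remQuot {q} (q ℕ.^ n) i)) ∷ residue n (proj₂ (remQuot {q} (q ℕ.^ n) i))

    length-residue : ∀ n i → length (residue n i) ≡ n
    length-residue zero i = refl
    length-residue (suc n) i = cong suc (length-residue n _)

    residue-injective : ∀ n {i j} → residue n i ≡ residue n j → i ≡ j
    residue-injective zero {zero} {zero} _ = refl
    residue-injective (suc n) {i} {j} e = ≡.trans (≡.sym (Fin.combine-remQuot {q} (q ℕ.^ n) i))
      (≡.trans (cong₂ (combine {q} {q ℕ.^ n}) (element-injective (List.∷-injectiveˡ e)) (residue-injective n (List.∷-injectiveʳ e)))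
               (Fin.combine-remQuot {q} (q ℕ.^ n) j))

    residues-incongruent : ∀ i j → i ≢ j → ¬ (v ∣ (residue ε i -ₚ residue ε j))
    residues-incongruent i j i≢j v∣i-j = i≢j (residue-injective ε
      (≃⇒≡ (≡.trans (length-residue ε i) (≡.sym (length-residue ε j))) (x-y≃0⇒x≃y (DegLt-ε-multiple difference<ε v∣i-j))))
      where
      residue<ε : ∀ i → DegLt (residue ε i) ε
      residue<ε i = ≡.subst (DegLt (residue ε i)) (length-residue ε i) (DegLt-length (residue ε i))
      difference<ε : DegLt (residue ε i -ₚ residue ε j) ε
      difference<ε = DegLt-+ (residue<ε i) (DegLt-neg (residue<ε j))

    incongruent-tabulate : ∀ n (g : Fin n → Poly) → (∀ i j → i ≢ j → ¬ (v ∣ (g i -ₚ g j))) → Incongruent (tabulate g)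
    incongruent-tabulate zero g _ = tt
    incongruent-tabulate (suc n) g g-inc =
      All.tabulate⁺ (λ j → g-inc (suc j) zero λ ()) ,
      incongruent-tabulate n (g ∘ suc) (λ i j i≢j → g-inc (suc i) (suc j) (i≢j ∘ Fin.suc-injective))

    -- X^N − X has N + 1 coefficients, so it cannot vanish on N + 1 distinct residues.
    not-all-roots : ∀ M → suc (suc M) < q ℕ.^ ε → ¬ (∀ x → v ∣ ((x ^ₚ suc (suc M)) -ₚ x))
    not-all-roots M N<qᵉ all-roots = v∤1 (v∣monomial⇒v∣1 M (All.tail (All.tail v∣X^-X)))
      where
      g : Fin (suc (suc (suc M))) → Poly
      g i = residue ε (inject≤ i N<qᵉ)
      v∣X^-X : All (v ∣_) (X^-X M)
      v∣X^-X = root-counting (suc (suc (suc M))) (X^-X M) (cong (ℕ.suc ∘ ℕ.suc) (length-monomial M)) (tabulate g) (List.length-tabulate g)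
        (incongruent-tabulate _ g (λ i j i≢j → residues-incongruent _ _ (i≢j ∘ Fin.inject≤-injective N<qᵉ N<qᵉ i j)))
        (All.tabulate⁺ {f = g} (λ i → ∣-respʳ (≃-sym (eval-X^-X M (g i))) (all-roots (g i))))

  -- If v ∣ [m] then x^(q^m) ≡ x for all x, so q^m ≥ q^ε residues are roots.
  v∣[m]⇒ε≤m : ∀ m → 1 ≤ m → v ∣ br m → ε ≤ m
  v∣[m]⇒ε≤m m 1≤m v∣[m] with ε ℕ.≤? m
  ... | yes ε≤m = ε≤m
  ... | no ε≰m = ⊥-elim (not-all-roots M (≡.subst (_< q ℕ.^ ε) qᵐ≡M+2 qᵐ<qᵉ)
                   λ x → ≡.subst (λ e → v ∣ ((x ^ₚ e) -ₚ x)) qᵐ≡M+2 (v∣difference (φ-≡v-id m v∣[m] x)))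
    where
    qᵐ<qᵉ : q ℕ.^ m < q ℕ.^ ε
    qᵐ<qᵉ = ℕ.^-monoʳ-< q 2≤q (ℕ.≰⇒> ε≰m)
    2≤qᵐ : 2 ≤ q ℕ.^ m
    2≤qᵐ = ℕ.≤-trans 2≤q (≡.subst (_≤ q ℕ.^ m) (ℕ.*-identityʳ q) (ℕ.^-monoʳ-≤ q {{ℕ.>-nonZero 1≤q}} 1≤m))
    M = q ℕ.^ m ∸ 2
    qᵐ≡M+2 : q ℕ.^ m ≡ suc (suc M)
    qᵐ≡M+2 = ≡.sym (≡.trans (ℕ.+-comm 2 M) (ℕ.m∸n+n≡m 2≤qᵐ))

  private
    eval-constants-θ : ∀ p → eval (map const p) θ ≃ p
    eval-constants-θ [] = ≃-refl
    eval-constants-θ (c ∷ p) = ≃-trans (+-cong (≃-refl {const c}) (*-cong (≃-refl {θ}) (eval-constants-θ p))) (≃-sym (∷-≃ c p))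

    φ-eval-constants : ∀ k p x → φ k (eval (map const p) x) ≃ eval (map const p) (φ k x)
    φ-eval-constants k [] x = φ-[] k
    φ-eval-constants k (c ∷ p) x = ≃-trans (φ-+ k (const c) (x *ₚ eval (map const p) x))
      (+-cong (φ-const k c) (≃-trans (φ-* k x _) (*-cong (≃-refl {φ k x}) (φ-eval-constants k p x))))

    coeff-take< : ∀ n p m → m < n → coeff (take n p) m ≡ coeff p m
    coeff-take< (suc n) [] m _ = refl
    coeff-take< (suc n) (a ∷ p) zero _ = refl
    coeff-take< (suc n) (a ∷ p) (suc m) (s≤s m<n) = coeff-take< n p m m<n

    coeff-take≥ : ∀ n p m → n ≤ m → coeff (take n p) m ≡ 0F
    coeff-take≥ zero p m _ = refl
    coeff-take≥ (suc n) [] m _ = refl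
    coeff-take≥ (suc n) (a ∷ p) (suc m) (s≤s n≤m) = coeff-take≥ n p m n≤m

    -- v with exactly ε + 1 coefficients
    v′ : Poly
    v′ = take (suc ε) v

    v′≃v : v′ ≃ v
    v′≃v = mk λ m → coeff-v′ m
      where
      coeff-v′ : ∀ m → coeff v′ m ≡ coeff v m
      coeff-v′ m with m ℕ.<? suc ε
      ... | yes m<ε+1 = coeff-take< (suc ε) v m m<ε+1
      ... | no m≮ε+1 = ≡.trans (coeff-take≥ (suc ε) v m (ℕ.≮⇒≥ m≮ε+1)) (≡.sym (coeff-≥ (proj₂ Deg-v) m (ℕ.≮⇒≥ m≮ε+1)))

    length-v′ : length (map const v′) ≡ suc ε
    length-v′ = ≡.trans (List.length-map const v′) (≡.trans (List.length-take (suc ε) v) (ℕ.m≤n⇒m⊓n≡m ε<|v|))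
      where
      ε<|v| : suc ε ≤ length v
      ε<|v| with suc ε ℕ.≤? length v
      ... | yes ε<|v| = ε<|v|
      ... | no ε≮|v| = ⊥-elim (proj₁ Deg-v (coeff-≥ (DegLt-length v) ε (ℕ.≤-pred (ℕ.≰⇒> ε≮|v|))))

    v∣constants⇒≡0 : ∀ p → All (v ∣_) (map const p) → ∀ m → coeff p m ≡ 0F
    v∣constants⇒≡0 [] _ m = refl
    v∣constants⇒≡0 (c ∷ p) (v∣c ∷ _) zero = v∣const⇒≡0 v∣c
    v∣constants⇒≡0 (c ∷ p) (_ ∷ v∣p) (suc m) = v∣constants⇒≡0 p v∣p m

    incongruent-to⊎congruent : ∀ m (h : Fin m → Poly) a
      → All (λ b → ¬ (v ∣ (b -ₚ a))) (tabulate h) ⊎ Σ (Fin m) (λ j → v ∣ (h j -ₚ a))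
    incongruent-to⊎congruent zero h a = inj₁ []
    incongruent-to⊎congruent (suc m) h a with v∣? (h zero -ₚ a) | incongruent-to⊎congruent m (h ∘ suc) a
    ... | yes v∣h₀-a | _ = inj₂ (zero , v∣h₀-a)
    ... | no v∤h₀-a | inj₁ v∤hs-a = inj₁ (v∤h₀-a ∷ v∤hs-a)
    ... | no _ | inj₂ (j , v∣hⱼ-a) = inj₂ (suc j , v∣hⱼ-a)

    incongruent⊎congruent : ∀ n (g : Fin n → Poly)
      → Incongruent (tabulate g) ⊎ Σ (Fin n) (λ i → Σ (Fin n) (λ j → toℕ i < toℕ j × v ∣ (g j -ₚ g i)))
    incongruent⊎congruent zero g = inj₁ tt
    incongruent⊎congruent (suc n) g with incongruent-to⊎congruent n (g ∘ suc) (g zero)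
    ... | inj₂ (j , v∣gⱼ-g₀) = inj₂ (zero , suc j , s≤s z≤n , v∣gⱼ-g₀)
    ... | inj₁ v∤gs-g₀ with incongruent⊎congruent n (g ∘ suc)
    ...   | inj₁ incongruent = inj₁ (v∤gs-g₀ , incongruent)
    ...   | inj₂ (i , j , i<j , v∣gⱼ-gᵢ) = inj₂ (suc i , suc j , s≤s i<j , v∣gⱼ-gᵢ)

  -- Among t 0, …, t ε two are congruent: otherwise they would be ε + 1 incongruent
  -- roots of v(X) = Σ v_k X^k, as v(t i) = φ i (v(θ)) = φ i v.
  v∣[ε] : v ∣ br ε
  v∣[ε] with incongruent⊎congruent (suc ε) (t ∘ toℕ)
  ... | inj₁ incongruent =
    ⊥-elim (1≢0 (≡.trans (≡.sym (proj₁ monic)) (≡.trans (≡.sym (coeff-≡ v′≃v ε)) (v∣constants⇒≡0 v′ v∣coefficients ε))))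
    where
    v-roots : All (λ r → v ∣ eval (map const v′) r) (tabulate (t ∘ toℕ))
    v-roots = All.tabulate⁺ {f = t ∘ toℕ} λ i →
      ∣-respʳ (≃-trans (φ-cong (toℕ i) (≃-sym (≃-trans (eval-constants-θ v′) v′≃v))) (φ-eval-constants (toℕ i) v′ θ)) (∣-φ (toℕ i) v)
    v∣coefficients : All (v ∣_) (map const v′)
    v∣coefficients = root-counting (suc ε) (map const v′) length-v′ (tabulate (t ∘ toℕ)) (List.length-tabulate (t ∘ toℕ)) incongruent v-roots
  ... | inj₂ (i , j , i<j , v∣tⱼ-tᵢ) = ≡.subst (λ e → v ∣ br e) j-i≡ε v∣[j-i]
    where
    a = toℕ i
    b = toℕ j
    tᵦ-tₐ≃φ[b-a] : (t b -ₚ t a) ≃ φ a (br (b ∸ a))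
    tᵦ-tₐ≃φ[b-a] = begin
      t b -ₚ t a
        ≈⟨ +-cong (≃-trans (^ₚ-congʳ θ (cong (q ℕ.^_) (≡.sym (ℕ.m∸n+n≡m (ℕ.<⇒≤ i<j))))) (≃-sym (φ-φ a (b ∸ a) θ))) ≃-refl ⟩
      φ a (t (b ∸ a)) -ₚ φ a θ         ≈⟨ φ-difference a (t (b ∸ a)) θ ⟨
      φ a (br (b ∸ a))                 ∎
    v∣[j-i] : v ∣ br (b ∸ a)
    v∣[j-i] = v∣^⇒v∣ (q ℕ.^ a) (∣-respʳ tᵦ-tₐ≃φ[b-a] v∣tⱼ-tᵢ)
    j-i≡ε : b ∸ a ≡ ε
    j-i≡ε = ℕ.≤-antisym (ℕ.≤-trans (ℕ.m∸n≤m b a) (ℕ.≤-pred (Fin.toℕ<n j))) (v∣[m]⇒ε≤m (b ∸ a) (ℕ.m<n⇒0<n∸m i<j) v∣[j-i])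

  t[αε]≡θ : ∀ α → t (α * ε) ≡v θ
  t[αε]≡θ zero = ≃⇒≡v (A.*-identityʳ θ)
  t[αε]≡θ (suc α) = ≡v-trans (≃⇒≡v (≃-sym (φ-φ (α * ε) ε θ))) (≡v-trans (≡v-^ (q ℕ.^ (α * ε)) ≡v⟨ v∣[ε] ⟩) (t[αε]≡θ α))

  v∣[αε] : ∀ α → v ∣ br (α * ε)
  v∣[αε] α = v∣difference (t[αε]≡θ α)

  v∤[αε+β] : ∀ α β → 1 ≤ β → β < ε → ¬ (v ∣ br (α * ε + β))
  v∤[αε+β] α β 1≤β β<ε v∣[αε+β] = ℕ.<⇒≱ β<ε (v∣[m]⇒ε≤m β 1≤β (v∣difference tβ≡θ))
    where
    tβ≡θ : t β ≡v θ
    tβ≡θ = ≡v-trans (≡v-sym (≡v-^ (q ℕ.^ β) (t[αε]≡θ α))) (≡v-trans (≃⇒≡v (φ-φ β (α * ε) θ)) ≡v⟨ v∣[αε+β] ⟩)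

  private
    der-^ₚ-q : ∀ g → der (g ^ₚ q) ≃ []
    der-^ₚ-q g = vanishes q refl
      where
      vanishes : ∀ n → n ≡ q → der (g ^ₚ n) ≃ []
      vanishes zero 0≡q with ≡.subst (2 ≤_) (≡.sym 0≡q) 2≤q
      ... | ()
      vanishes (suc n) n+1≡q = ≃-trans (der-^ₚ g n)
        (*-cong (≃-trans (const-cong (≡.trans (cong (_×F 1F) n+1≡q) q×1≡0)) const-0) (≃-refl {(g ^ₚ n) *ₚ der g}))

    der-[j] : ∀ j → 1 ≤ j → der (br j) ≃ (-ₚ 1ₚ)
    der-[j] (suc j) _ = begin
      der ((θ ^ₚ (q ℕ.^ suc j)) -ₚ θ)                 ≈⟨ der-+ (θ ^ₚ (q ℕ.^ suc j)) (-ₚ θ) ⟩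
      der (θ ^ₚ (q ℕ.^ suc j)) +ₚ der (-ₚ θ)          ≈⟨ +-cong (der-cong θ^qʲ⁺¹≃) (der-neg θ) ⟩
      der ((θ ^ₚ (q ℕ.^ j)) ^ₚ q) +ₚ (-ₚ der θ)       ≈⟨ +-cong (der-^ₚ-q (θ ^ₚ (q ℕ.^ j))) (-‿cong der-θ) ⟩
      -ₚ 1ₚ                                          ∎
      where
      θ^qʲ⁺¹≃ : (θ ^ₚ (q ℕ.^ suc j)) ≃ ((θ ^ₚ (q ℕ.^ j)) ^ₚ q)
      θ^qʲ⁺¹≃ = ≃-trans (^ₚ-congʳ θ (ℕ.*-comm q (q ℕ.^ j))) (≃-sym (^ₚ-assocʳ θ (q ℕ.^ j) q))

  -- v² ∣ [j] would make v divide [j]′ = −1.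
  [j]-squarefree : ∀ j → 1 ≤ j → ¬ ((v *ₚ v) ∣ br j)
  [j]-squarefree j 1≤j (divides w v²w≃[j]) = v∤1 (∣-respʳ (RingProperties.-‿involutive A.ring 1ₚ) (∣-neg v∣-1))
    where
    v∣-1 : v ∣ (-ₚ 1ₚ)
    v∣-1 = ∣-respʳ (≃-trans (≃-sym (der-* v (v *ₚ w))) (≃-trans (der-cong (≃-trans (≃-sym (*-assoc v v w)) v²w≃[j])) (der-[j] j 1≤j)))
                   (∣-+ (∣-*ˡ (der v) (∣-*ₚ v w)) (∣-*ₚ v (der (v *ₚ w))))

module Valuation (𝔽 : FiniteField) (v : Carlitz.Poly 𝔽) (ε : ℕ)
         (monic : Carlitz.MonicOfDegree 𝔽 v ε) (irreducible : Carlitz.Irreducible 𝔽 v) where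
  open import Data.Nat using (_+_; _*_)
  open FiniteField 𝔽
  open Carlitz 𝔽
  open Polynomials 𝔽
  open Degrees 𝔽
  open Divisibility 𝔽
  open IrreducibleFactor 𝔽 v ε monic irreducible
  open CarlitzBrackets 𝔽 v ε monic irreducible using ([j]-squarefree)
  open A-Solver using (solve; _:=_; _:*_; :-_)
  open ≃-Reasoning

  -- A factorisation witnessing ord_v f = n; unlike HasOrd it is visibly multiplicative.
  record Ord (f : Poly) (n : ℕ) : Set where
    constructor ord
    field
      cofactor : Poly
      factorisation : f ≃ ((v ^ₚ n) *ₚ cofactor)
      v∤cofactor : ¬ (v ∣ cofactor)

  v^≄0 : ∀ n → ¬ ((v ^ₚ n) ≃ [])
  v^≄0 zero = Deg⇒≄0 Deg-1ₚ
  v^≄0 (suc n) = *-≄0 (Deg⇒≄0 Deg-v) (v^≄0 n)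

  Ord⇒HasOrd : ∀ {f n} → Ord f n → HasOrd v f n
  Ord⇒HasOrd {f} {n} (ord u f≃vⁿu v∤u) =
    ∣⇒∣ₚ {v ^ₚ n} (divides u (≃-sym f≃vⁿu)) , λ vⁿ⁺¹∣ₚf → v∤u (v∣u (∣ₚ⇒∣ vⁿ⁺¹∣ₚf))
    where
    v∣u : v ^ₚ suc n ∣ f → v ∣ u
    v∣u (divides w vⁿ⁺¹w≃f) = divides w (*-cancelˡ (v^≄0 n) (begin
      (v ^ₚ n) *ₚ (v *ₚ w)    ≈⟨ solve 3 (λ a v w → a :* (v :* w) := (v :* a) :* w) ≃-refl (v ^ₚ n) v w ⟩
      (v ^ₚ suc n) *ₚ w       ≈⟨ vⁿ⁺¹w≃f ⟩
      f                       ≈⟨ f≃vⁿu ⟩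
      (v ^ₚ n) *ₚ u           ∎))

  Ord-* : ∀ {f g a b} → Ord f a → Ord g b → Ord (f *ₚ g) (a + b)
  Ord-* {f} {g} {a} {b} (ord u f≃vᵃu v∤u) (ord u′ g≃vᵇu′ v∤u′) =
    ord (u *ₚ u′) fg≃ λ v∣uu′ → [ v∤u , v∤u′ ] (euclid u u′ v∣uu′)
    where
    fg≃ : (f *ₚ g) ≃ ((v ^ₚ (a + b)) *ₚ (u *ₚ u′))
    fg≃ = begin
      f *ₚ g                                  ≈⟨ *-cong f≃vᵃu g≃vᵇu′ ⟩
      ((v ^ₚ a) *ₚ u) *ₚ ((v ^ₚ b) *ₚ u′)     ≈⟨ solve 4 (λ A B x y → (A :* x) :* (B :* y) := (A :* B) :* (x :* y)) ≃-refl (v ^ₚ a) (v ^ₚ b) u u′ ⟩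
      ((v ^ₚ a) *ₚ (v ^ₚ b)) *ₚ (u *ₚ u′)     ≈⟨ *-cong (^ₚ-homo-* v a b) ≃-refl ⟨
      (v ^ₚ (a + b)) *ₚ (u *ₚ u′)             ∎

  Ord-neg : ∀ {f a} → Ord f a → Ord (-ₚ f) a
  Ord-neg {f} {a} (ord u f≃vᵃu v∤u) =
    ord (-ₚ u) (≃-trans (-‿cong f≃vᵃu) (solve 2 (λ A x → :- (A :* x) := A :* (:- x)) ≃-refl (v ^ₚ a) u))
        (λ v∣-u → v∤u (∣-respʳ (RingProperties.-‿involutive A.ring u) (∣-neg v∣-u)))

  Ord-1ₚ : Ord 1ₚ 0
  Ord-1ₚ = ord 1ₚ (≃-sym (*-identityˡ 1ₚ)) v∤1

  Ord-^ₚ : ∀ {f a} n → Ord f a → Ord (f ^ₚ n) (n * a)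
  Ord-^ₚ zero _ = Ord-1ₚ
  Ord-^ₚ (suc n) o = Ord-* o (Ord-^ₚ n o)

  Ord-[j]-1 : ∀ j → 1 ≤ j → v ∣ br j → Ord (br j) 1
  Ord-[j]-1 j 1≤j (divides w vw≃[j]) =
    ord w (≃-trans (≃-sym vw≃[j]) (*-cong (≃-sym (A.*-identityʳ v)) ≃-refl))
        λ { (divides w′ vw′≃w) → [j]-squarefree j 1≤j (divides w′ (≃-trans (*-assoc v v w′) (≃-trans (*-cong (≃-refl {v}) vw′≃w) vw≃[j]))) }

  Ord-[j]-0 : ∀ j → ¬ (v ∣ br j) → Ord (br j) 0
  Ord-[j]-0 j v∤[j] = ord (br j) (≃-sym (*-identityˡ (br j))) v∤[j]

module FactorialValuations (𝔽 : FiniteField) (v : Carlitz.Poly 𝔽) (ε : ℕ)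
         (monic : Carlitz.MonicOfDegree 𝔽 v ε) (irreducible : Carlitz.Irreducible 𝔽 v) where
  open import Data.Nat using (_+_; _∸_; _*_; _^_; _%_; _/_)
  open import Data.Nat.Tactic.RingSolver using (solve-∀)
  open FiniteField 𝔽
  open Carlitz 𝔽
  open FiniteFieldArithmetic 𝔽 using (2≤q; 1≤q)
  open IrreducibleFactor 𝔽 v ε monic irreducible using (1≤ε)
  open CarlitzBrackets 𝔽 v ε monic irreducible using (v∣[αε]; v∤[αε+β])
  open Divisibility 𝔽 using (_∣_)
  open Valuation 𝔽 v ε monic irreducible

  qᵥ : ℕ
  qᵥ = q ^ ε

  -- 1 + qᵥ + ⋯ + qᵥ^(α−1) = (qᵥ^α − 1) / (qᵥ − 1)
  geometric : ℕ → ℕ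
  geometric zero = 0
  geometric (suc α) = 1 + qᵥ * geometric α

  private
    1≤qᵥ : 1 ≤ qᵥ
    1≤qᵥ = ℕ.m^n>0 q {{ℕ.>-nonZero 1≤q}} ε

  geometric-sum : ∀ α → geometric α * (qᵥ ∸ 1) + 1 ≡ qᵥ ^ α
  geometric-sum zero = refl
  geometric-sum (suc α) = begin
    (1 + qᵥ * geometric α) * (qᵥ ∸ 1) + 1            ≡⟨ cong (λ z → (1 + z * geometric α) * (qᵥ ∸ 1) + 1) (≡.sym qᵥ-1+1) ⟩
    (1 + ((qᵥ ∸ 1) + 1) * geometric α) * (qᵥ ∸ 1) + 1 ≡⟨ geometric-step (qᵥ ∸ 1) (geometric α) ⟩
    ((qᵥ ∸ 1) + 1) * (geometric α * (qᵥ ∸ 1) + 1)     ≡⟨ ≡.cong₂ _*_ qᵥ-1+1 (geometric-sum α) ⟩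
    qᵥ * qᵥ ^ α                                      ∎
    where
    open ≡.≡-Reasoning
    qᵥ-1+1 : (qᵥ ∸ 1) + 1 ≡ qᵥ
    qᵥ-1+1 = ℕ.m∸n+n≡m 1≤qᵥ
    geometric-step : ∀ d g → (1 + (d + 1) * g) * d + 1 ≡ (d + 1) * (g * d + 1)
    geometric-step = solve-∀

  private
    instance
      ε-nonZero : ℕ.NonZero ε
      ε-nonZero = ℕ.>-nonZero 1≤ε

    ε-1+1 : suc (ε ∸ 1) ≡ ε
    ε-1+1 = ≡.trans (ℕ.+-comm 1 (ε ∸ 1)) (ℕ.m∸n+n≡m 1≤ε)

    [α+1]ε : ∀ α → suc α * ε ≡ suc (α * ε + (ε ∸ 1))
    [α+1]ε α = ≡.trans (cong (_+ α * ε) (≡.sym ε-1+1)) (cong suc (ℕ.+-comm (ε ∸ 1) (α * ε)))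

  -- D_{i+1} = [i+1] D_i^q and L_{i+1} = −[i+1] L_i, where v ∣ [i+1] (simply) iff ε ∣ i + 1.
  Ord-D : ∀ α β → β < ε → Ord (D (α * ε + β)) (q ^ β * geometric α)
  Ord-D zero zero _ = Ord-1ₚ
  Ord-D (suc α) zero _ = ≡.subst (λ i → Ord (D i) (q ^ 0 * geometric (suc α))) (≡.sym (≡.trans (ℕ.+-identityʳ _) ([α+1]ε α)))
    (≡.subst (Ord (D i)) ord≡ (Ord-* (Ord-[j]-1 i (s≤s z≤n) (≡.subst (λ i → v ∣ br i) ([α+1]ε α) (v∣[αε] (suc α))))
                                     (Ord-^ₚ q (Ord-D α (ε ∸ 1) (≡.subst (ε ∸ 1 <_) ε-1+1 ℕ.≤-refl)))))
    where
    i = suc (α * ε + (ε ∸ 1))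
    ord≡ : 1 + q * (q ^ (ε ∸ 1) * geometric α) ≡ q ^ 0 * geometric (suc α)
    ord≡ = ≡.trans (cong suc (≡.trans (≡.sym (ℕ.*-assoc q (q ^ (ε ∸ 1)) _)) (cong (λ e → q ^ e * geometric α) ε-1+1)))
                   (≡.sym (ℕ.*-identityˡ _))
  Ord-D α (suc β) β+1<ε = ≡.subst (λ i → Ord (D i) (q ^ suc β * geometric α)) (≡.sym (ℕ.+-suc (α * ε) β))
    (≡.subst (Ord (D (suc (α * ε + β)))) (≡.sym (ℕ.*-assoc q (q ^ β) _))
      (Ord-* (Ord-[j]-0 (suc (α * ε + β)) (≡.subst (λ i → ¬ (v ∣ br i)) (ℕ.+-suc (α * ε) β) (v∤[αε+β] α (suc β) (s≤s z≤n) β+1<ε)))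
             (Ord-^ₚ q (Ord-D α β (ℕ.<-trans (ℕ.n<1+n β) β+1<ε)))))

  Ord-L : ∀ α β → β < ε → Ord (L (α * ε + β)) α
  Ord-L zero zero _ = Ord-1ₚ
  Ord-L (suc α) zero _ = ≡.subst (λ i → Ord (L i) (suc α)) (≡.sym (≡.trans (ℕ.+-identityʳ _) ([α+1]ε α)))
    (Ord-neg (Ord-* (Ord-[j]-1 (suc (α * ε + (ε ∸ 1))) (s≤s z≤n) (≡.subst (λ i → v ∣ br i) ([α+1]ε α) (v∣[αε] (suc α))))
                   (Ord-L α (ε ∸ 1) (≡.subst (ε ∸ 1 <_) ε-1+1 ℕ.≤-refl))))
  Ord-L α (suc β) β+1<ε = ≡.subst (λ i → Ord (L i) α) (≡.sym (ℕ.+-suc (α * ε) β))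
    (Ord-neg (Ord-* (Ord-[j]-0 (suc (α * ε + β)) (≡.subst (λ i → ¬ (v ∣ br i)) (ℕ.+-suc (α * ε) β) (v∤[αε+β] α (suc β) (s≤s z≤n) β+1<ε)))
                   (Ord-L α β (ℕ.<-trans (ℕ.n<1+n β) β+1<ε))))

  Ord-D-bound : ∀ j → Σ ℕ (λ o → Ord (D j) o × o * (qᵥ ∸ 1) + 1 ≤ q ^ j)
  Ord-D-bound j = q ^ β * geometric α , ≡.subst (λ i → Ord (D i) (q ^ β * geometric α)) (≡.sym j≡αε+β) (Ord-D α β (ℕ.m%n<n j ε)) , bound
    where
    open ℕ.≤-Reasoning
    α = j / ε
    β = j % ε
    j≡αε+β : j ≡ α * ε + β
    j≡αε+β = ≡.trans (ℕ.m≡m%n+[m/n]*n j ε) (ℕ.+-comm β (α * ε))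
    bound : q ^ β * geometric α * (qᵥ ∸ 1) + 1 ≤ q ^ j
    bound = begin
      q ^ β * geometric α * (qᵥ ∸ 1) + 1     ≤⟨ ℕ.+-monoʳ-≤ _ (ℕ.m^n>0 q {{ℕ.>-nonZero 1≤q}} β) ⟩
      q ^ β * geometric α * (qᵥ ∸ 1) + q ^ β ≡⟨ factor-out (q ^ β) (geometric α) (qᵥ ∸ 1) ⟩
      q ^ β * (geometric α * (qᵥ ∸ 1) + 1)   ≡⟨ cong (q ^ β *_) (geometric-sum α) ⟩
      q ^ β * qᵥ ^ α                          ≡⟨ cong (q ^ β *_) (ℕ.^-*-assoc q ε α) ⟩
      q ^ β * q ^ (ε * α)                     ≡⟨ ℕ.^-distribˡ-+-* q β (ε * α) ⟨
      q ^ (β + ε * α)                         ≡⟨ cong (q ^_) (≡.trans (ℕ.+-comm β (ε * α)) (≡.trans (cong (_+ β) (ℕ.*-comm ε α)) (≡.sym j≡αε+β))) ⟩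
      q ^ j                                   ∎
      where
      factor-out : ∀ a g d → a * g * d + a ≡ a * (g * d + 1)
      factor-out = solve-∀

  nonzero : ℕ → ℕ
  nonzero zero = 0
  nonzero (suc _) = 1

  private
    nonzero≤1 : ∀ {n} → nonzero n ≤ 1
    nonzero≤1 {zero} = z≤n
    nonzero≤1 {suc _} = ℕ.≤-refl

    digit-bound : ∀ d {A B P Q a b} → A + 1 ≤ P → B + b ≤ Q → (d ≡ 0 → a ≤ b) → a ≤ 1 → d * A + B + a ≤ d * P + Q
    digit-bound zero {B = B} _ B+b≤Q a≤b _ = ℕ.≤-trans (ℕ.+-monoʳ-≤ B (a≤b refl)) B+b≤Q
    digit-bound (suc d) {A} {B} {P} {Q} {b = b} A+1≤P B+b≤Q _ a≤1 = begin
      suc d * A + B + _              ≤⟨ ℕ.+-monoʳ-≤ (suc d * A + B) a≤1 ⟩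
      suc d * A + B + 1              ≡⟨ move-1 d A B ⟩
      (suc d * A + 1) + B            ≤⟨ ℕ.+-monoˡ-≤ B (ℕ.+-monoʳ-≤ (suc d * A) (s≤s z≤n)) ⟩
      (suc d * A + suc d) + B        ≡⟨ collect d A B ⟩
      suc d * (A + 1) + B            ≤⟨ ℕ.+-mono-≤ (ℕ.*-monoʳ-≤ (suc d) A+1≤P) (ℕ.≤-trans (ℕ.m≤m+n B b) B+b≤Q) ⟩
      suc d * P + Q                  ∎
      where
      open ℕ.≤-Reasoning
      move-1 : ∀ d A B → suc d * A + B + 1 ≡ (suc d * A + 1) + B
      move-1 = solve-∀
      collect : ∀ d A B → (suc d * A + suc d) + B ≡ suc d * (A + 1) + B
      collect = solve-∀

  Γ≡digitProd : ∀ n {k} → q ≡ suc k → Γ (suc n) ≡ digitProd k n zero n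
  Γ≡digitProd n q≡k+1 with q | q≡k+1
  ... | .(suc _) | refl = refl

  module _ (k : ℕ) (q≡k+1 : q ≡ suc k) where
    Ord-digitProd : ∀ f j n → n < suc k ^ f → Σ ℕ (λ o → Ord (digitProd k f j n) o × o * (qᵥ ∸ 1) + nonzero n ≤ suc k ^ j * n)
    Ord-digitProd zero j zero _ = 0 , Ord-1ₚ , z≤n
    Ord-digitProd zero j (suc n) (s≤s ())
    Ord-digitProd (suc f) j n n<Kᶠ⁺¹
      with Ord-D-bound j | Ord-digitProd f (suc j) (n / suc k) (ℕ.m<n*o⇒m/o<n (≡.subst (n <_) (ℕ.*-comm (suc k) (suc k ^ f)) n<Kᶠ⁺¹))
    ... | oD , ord-D , oD-bound | o , ord-rest , rest-bound =
      n % suc k * oD + o , Ord-* (Ord-^ₚ (n % suc k) ord-D) ord-rest , (begin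
        (d * oD + o) * (qᵥ ∸ 1) + nonzero n           ≡⟨ cong (_+ nonzero n) (distribute d oD o (qᵥ ∸ 1)) ⟩
        d * (oD * (qᵥ ∸ 1)) + o * (qᵥ ∸ 1) + nonzero n
          ≤⟨ digit-bound d (≡.subst (λ K → oD * (qᵥ ∸ 1) + 1 ≤ K ^ j) q≡k+1 oD-bound) rest-bound d≡0⇒ nonzero≤1 ⟩
        d * suc k ^ j + suc k ^ suc j * m              ≡⟨ collect-digits d (suc k ^ j) m (suc k) ⟩
        suc k ^ j * (d + m * suc k)                    ≡⟨ cong (suc k ^ j *_) n≡d+mK ⟨
        suc k ^ j * n                                  ∎)
      where
      open ℕ.≤-Reasoning
      d = n % suc k
      m = n / suc k
      n≡d+mK : n ≡ d + m * suc k
      n≡d+mK = ℕ.m≡m%n+[m/n]*n n (suc k)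
      d≡0⇒ : d ≡ 0 → nonzero n ≤ nonzero m
      d≡0⇒ d≡0 = by-cases m n≡d+mK
        where
        by-cases : ∀ m′ → n ≡ d + m′ * suc k → nonzero n ≤ nonzero m′
        by-cases (suc _) _ = nonzero≤1
        by-cases zero n≡d+0 = ℕ.≤-reflexive (cong nonzero (≡.trans n≡d+0 (≡.trans (ℕ.+-identityʳ d) d≡0)))
      distribute : ∀ d a o e → (d * a + o) * e ≡ d * (a * e) + o * e
      distribute = solve-∀
      collect-digits : ∀ d P m K → d * P + (K * P) * m ≡ P * (d + m * K)
      collect-digits = solve-∀

    private
      n<Kⁿ : ∀ n → n < suc k ^ n
      n<Kⁿ zero = s≤s z≤n
      n<Kⁿ (suc n) = begin-strict
        suc n                   <⟨ s≤s (n<Kⁿ n) ⟩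
        suc (suc k ^ n)         ≤⟨ ℕ.+-monoˡ-≤ (suc k ^ n) (ℕ.m^n>0 (suc k) n) ⟩
        suc k ^ n + suc k ^ n   ≡⟨ cong (suc k ^ n +_) (ℕ.+-identityʳ (suc k ^ n)) ⟨
        2 * suc k ^ n           ≤⟨ ℕ.*-monoˡ-≤ (suc k ^ n) (≡.subst (2 ≤_) q≡k+1 2≤q) ⟩
        suc k * suc k ^ n       ∎
        where open ℕ.≤-Reasoning

    Ord-Γ′ : ∀ n → Σ ℕ (λ o → Ord (Γ (suc n)) o × o * (qᵥ ∸ 1) + nonzero n ≤ n)
    Ord-Γ′ n with Ord-digitProd n zero n (n<Kⁿ n)
    ... | o , ord-Π , bound =
      o , ≡.subst (λ g → Ord g o) (≡.sym (Γ≡digitProd n q≡k+1)) ord-Π , ≡.subst (o * (qᵥ ∸ 1) + nonzero n ≤_) (ℕ.*-identityˡ n) bound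

  private
    q≡q∸1+1 : q ≡ suc (q ∸ 1)
    q≡q∸1+1 = ≡.sym (≡.trans (ℕ.+-comm 1 (q ∸ 1)) (ℕ.m∸n+n≡m 1≤q))

  Ord-Γ : ∀ n → Σ ℕ (λ o → Ord (Γ (suc n)) o × o * (qᵥ ∸ 1) + nonzero n ≤ n)
  Ord-Γ = Ord-Γ′ (q ∸ 1) q≡q∸1+1

  private
    Ord-Γ-weight : ∀ s → 1 ≤ s → Σ ℕ (λ o → Ord (Γ s) o × o * (qᵥ ∸ 1) + (1 + ht (s ∷ [])) ≤ s)
    Ord-Γ-weight (suc n) _ with Ord-Γ n
    ... | o , ord-Γ , bound = o , ord-Γ , shift n bound
      where
      shift : ∀ n → o * (qᵥ ∸ 1) + nonzero n ≤ n → o * (qᵥ ∸ 1) + (1 + ht (suc n ∷ [])) ≤ suc n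
      shift zero b = ≡.subst (_≤ 1) (≡.sym (ℕ.+-comm (o * (qᵥ ∸ 1)) 1)) (s≤s (ℕ.≤-trans (ℕ.≤-reflexive (≡.sym (ℕ.+-identityʳ _))) b))
      shift (suc n) b = ≡.subst (_≤ suc (suc n)) (≡.sym (ℕ.+-suc (o * (qᵥ ∸ 1)) 1)) (s≤s b)

    ht-∷ : ∀ s 𝔰 → 1 ≤ s → ht (s ∷ 𝔰) ≡ ht (s ∷ []) + ht 𝔰
    ht-∷ (suc zero) 𝔰 _ = refl
    ht-∷ (suc (suc _)) 𝔰 _ = refl

  Ord-Γ-idx : ∀ 𝔰 → All (1 ≤_) 𝔰 → Σ ℕ (λ o → Ord (Γ-idx 𝔰) o × o * (qᵥ ∸ 1) + (dep 𝔰 + ht 𝔰) ≤ wt 𝔰)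
  Ord-Γ-idx [] [] = 0 , Ord-1ₚ , z≤n
  Ord-Γ-idx (s ∷ 𝔰) (1≤s ∷ 1≤𝔰) with Ord-Γ-weight s 1≤s | Ord-Γ-idx 𝔰 1≤𝔰
  ... | o , ord-Γ , bound | o′ , ord-Γ′ , bound′ = o + o′ , Ord-* ord-Γ ord-Γ′ , (begin
    (o + o′) * e + (suc (dep 𝔰) + ht (s ∷ 𝔰))                      ≡⟨ cong (λ h → (o + o′) * e + (suc (dep 𝔰) + h)) (ht-∷ s 𝔰 1≤s) ⟩
    (o + o′) * e + (suc (dep 𝔰) + (ht (s ∷ []) + ht 𝔰))            ≡⟨ regroup o o′ e (dep 𝔰) (ht (s ∷ [])) (ht 𝔰) ⟩
    (o * e + (1 + ht (s ∷ []))) + (o′ * e + (dep 𝔰 + ht 𝔰))         ≤⟨ ℕ.+-mono-≤ bound bound′ ⟩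
    s + wt 𝔰                                                       ∎)
    where
    open ℕ.≤-Reasoning
    e = qᵥ ∸ 1
    regroup : ∀ o o′ e d h h′ → (o + o′) * e + (suc d + (h + h′)) ≡ (o * e + (1 + h)) + (o′ * e + (d + h′))
    regroup = solve-∀

  ord-D-L : ∀ i α β → i ≡ α * ε + β → β < ε
    → Σ ℕ (λ n → HasOrd v (D i) n × n * (qᵥ ∸ 1) ≡ q ^ β * (qᵥ ^ α ∸ 1)) × HasOrd v (L i) α
  ord-D-L i α β refl β<ε =
    (q ^ β * geometric α , Ord⇒HasOrd (Ord-D α β β<ε) , geometric-arith) , Ord⇒HasOrd (Ord-L α β β<ε)
    where
    geometric-arith : q ^ β * geometric α * (qᵥ ∸ 1) ≡ q ^ β * (qᵥ ^ α ∸ 1)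
    geometric-arith = ≡.trans (ℕ.*-assoc (q ^ β) (geometric α) (qᵥ ∸ 1))
      (cong (q ^ β *_) (≡.trans (≡.sym (ℕ.m+n∸n≡m (geometric α * (qᵥ ∸ 1)) 1)) (cong (_∸ 1) (geometric-sum α))))

  ord-Γ₁ : HasOrd v (Γ 1) 0
  ord-Γ₁ = Ord⇒HasOrd (≡.subst (λ g → Ord g 0) (≡.sym (Γ≡digitProd 0 q≡q∸1+1)) Ord-1ₚ)

  ord-Γ : ∀ s → 2 ≤ s → Σ ℕ (λ n → HasOrd v (Γ s) n × n * (qᵥ ∸ 1) ≤ s ∸ 2)
  ord-Γ (suc (suc n)) (s≤s (s≤s z≤n)) = o , Ord⇒HasOrd ord-Γₛ , ℕ.≤-pred (≡.subst (_≤ suc n) (ℕ.+-comm (o * (qᵥ ∸ 1)) 1) bound)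
    where
    o = proj₁ (Ord-Γ (suc n))
    ord-Γₛ : Ord (Γ (suc (suc n))) o
    ord-Γₛ = proj₁ (proj₂ (Ord-Γ (suc n)))
    bound : o * (qᵥ ∸ 1) + 1 ≤ suc n
    bound = proj₂ (proj₂ (Ord-Γ (suc n)))

  ord-Γ-idx : ∀ 𝔰 → All (1 ≤_) 𝔰 → Σ ℕ (λ n → HasOrd v (Γ-idx 𝔰) n × n * (qᵥ ∸ 1) ≤ wt 𝔰 ∸ dep 𝔰 ∸ ht 𝔰)
  ord-Γ-idx 𝔰 1≤𝔰 with Ord-Γ-idx 𝔰 1≤𝔰
  ... | o , ord-Γ , bound = o , Ord⇒HasOrd ord-Γ ,
    ≡.subst (o * (qᵥ ∸ 1) ≤_) (≡.sym (ℕ.∸-+-assoc (wt 𝔰) (dep 𝔰) (ht 𝔰))) (ℕ.m+n≤o⇒m≤o∸n (o * (qᵥ ∸ 1)) bound)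

open import Data.Nat using (_+_; _*_; _∸_; _^_)

proposition2p1 :
    (𝔽 : FiniteField) (v : Carlitz.Poly 𝔽) (εv : ℕ) →
    Carlitz.MonicOfDegree 𝔽 v εv → Carlitz.Irreducible 𝔽 v →
    let open FiniteField 𝔽 in
    let open Carlitz 𝔽 in
    let qv = q ^ εv in
    -- (1)
    (∀ (i α β : ℕ) → i ≡ α * εv + β → β < εv →
      Σ ℕ (λ n → HasOrd v (D i) n × n * (qv ∸ 1) ≡ q ^ β * (qv ^ α ∸ 1))
      × HasOrd v (L i) α)
    -- (2)
    × HasOrd v (Γ 1) 0
    × (∀ (s : ℕ) → 2 ≤ s → Σ ℕ (λ n → HasOrd v (Γ s) n × n * (qv ∸ 1) ≤ s ∸ 2))
    × (∀ (𝔰 : List ℕ) → All (λ s → 1 ≤ s) 𝔰 →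
      Σ ℕ (λ n → HasOrd v (Γ-idx 𝔰) n × n * (qv ∸ 1) ≤ wt 𝔰 ∸ dep 𝔰 ∸ ht 𝔰))
proposition2p1 𝔽 v εv monic irreducible = ord-D-L , ord-Γ₁ , ord-Γ , ord-Γ-idx
  where open FactorialValuations 𝔽 v εv monic irreducible
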